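{- Let $k$ be a positive integer, let $G$ be a graph of order $n$ and let $v$ be a vertex of $G$. If $G$ contains no path on $2k+1$ vertices whose two endvertices are both different from $v$, then \[ 2e(G)-d_{v}\leq (2k-1)(n-1), \] unless $G$ is a disjoint union of several copies of $K_{2k}$ and one copy of $K_{2k}+v$.
   Context: All graphs are finite and simple. $e(G)$ is the number of edges of $G$, $d_v$ the degree of $v$, $K_{m}$ the complete graph on $m$ vertices. $K_{2k}+v$ denotes the graph obtained by joining the vertex $v$ to a single vertex of a complete graph $K_{2k}$ (so $v$ has degree 1 in it). -}

module Defs where

open import Data.Nat using (ℕ; zero; suc; _+_; _*_; _<ᵇ_)
open import Data.Bool using (Bool; true; false; _∧_)
open import Data.Fin using (Fin; toℕ; inject₁; fromℕ) renaming (zero to fzero; suc to fsuc)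
open import Data.Fin.Properties using (_≟_)
open import Data.List using (List; length; filterᵇ; map)
open import Data.Nat.ListAction using (sum)
open import Data.List.Base using (allFin)
open import Data.Product using (Σ; ∃; _×_; _,_)
open import Relation.Nullary using (¬_; does)
open import Relation.Binary.PropositionalEquality using (_≡_; _≢_)
open import Function using (_⇔_)
open import Function.Definitions using (Injective)

record Graph (n : ℕ) : Set where
  field
    adj   : Fin n → Fin n → Bool
    sym   : ∀ x y → adj x y ≡ adj y x
    irrefl : ∀ x → adj x x ≡ false
open Graph public

Adj : ∀ {n} → Graph n → Fin n → Fin n → Set
Adj G x y = adj G x y ≡ true

degree : ∀ {n} → Graph n → Fin n → ℕ
degree {n} G v = length (filterᵇ (adj G v) (allFin n))

edges : ∀ {n} → Graph n → ℕ
edges {n} G = sum (map (λ x → length (filterᵇ (λ y → (toℕ x <ᵇ toℕ y) ∧ adj G x y) (allFin n))) (allFin n))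

-- G contains a path on m+1 vertices (distinct vertices p 0, …, p m, consecutive
-- ones adjacent) whose two end vertices are both different from v.
HasPathAvoidingEnds : ∀ {n} → Graph n → Fin n → ℕ → Set
HasPathAvoidingEnds {n} G v m =
  Σ (Fin (suc m) → Fin n) λ p →
    Injective _≡_ _≡_ p
    × (∀ (i : Fin m) → Adj G (p (inject₁ i)) (p (fsuc i)))
    × p fzero ≢ v
    × p (fromℕ m) ≢ v

classSize : ∀ {n} → (Fin n → ℕ) → ℕ → ℕ
classSize {n} c l = length (filterᵇ (λ y → does (Data.Nat._≟_ (c y) l)) (allFin n))

-- G is a disjoint union of (zero or more) copies of K_{2k} together with one copy
-- of K_{2k}+v, where v is the pendant vertex of the K_{2k}+v component.
-- Components are given by a labelling c; u is the neighbour of v.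
IsExceptional : ∀ {n} → ℕ → Graph n → Fin n → Set
IsExceptional {n} k G v =
  Σ (Fin n → ℕ) λ c → Σ (Fin n) λ u →
    u ≢ v
    × c u ≡ c v
    × (∀ y → Adj G v y ⇔ (y ≡ u))
    × (∀ x y → x ≢ v → y ≢ v → (Adj G x y ⇔ (x ≢ y × c x ≡ c y)))
    × classSize c (c v) ≡ suc (2 * k)
    × (∀ x → c x ≢ c v → classSize c (c x) ≡ 2 * k)

module Submission where

-- Write weight U = 2e(U) + d_U(v) for a vertex set U ∌ v; then 2e(G) − d_v = weight (V − v). By
-- induction on |U| one proves the stronger pair of statements (Claim below): weight U ≤ (2k−1)|U| unless
-- U spans disjoint copies of K_{2k} and v has exactly one neighbour in U, and weight U < (2k−1)|U| if v has
-- no neighbour in U, unless U spans disjoint copies of K_{2k}.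
-- A vertex of degree d < k in U carries 2d + 1 ≤ 2k − 1 of the weight and is deleted. Otherwise take a
-- longest path in U: it has at most 2k vertices, since its ends differ from v, and by Pósa's argument
-- (both ends have all their ≥ k neighbours on it) its vertex set carries a cycle C from which no edge leaves
-- inside U. Deleting C costs 2e(C) + d_C(v) ≤ |C|² ≤ (2k−1)|C| if |C| < 2k. If |C| = 2k, any two neighbours
-- of v on C would yield a forbidden path through v, so d_C(v) ≤ 1, and the bound is tight only when C is a
-- clique, i.e. a new K_{2k} component of an exceptional configuration.

open import Defs hiding (sym)
open Defs.Graph using () renaming (sym to gsym)
open import Data.Nat using (ℕ; zero; suc; _+_; _*_; _∸_; _≤_; _<_; z≤n; s≤s; _≡ᵇ_; _<ᵇ_; _≤?_)
open import Data.Nat.Properties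
open import Data.Bool using (Bool; true; false; _∧_; _∨_; not; if_then_else_)
open import Data.Fin using (Fin; toℕ; inject₁; fromℕ) renaming (zero to fzero; suc to fsuc)
open import Data.List using (List; []; _∷_; _++_; length; reverse; head; filterᵇ; map; allFin; tabulate; take; drop)
open import Data.Nat.ListAction using (sum)
open import Data.Product using (Σ-syntax; _×_; _,_; proj₁; proj₂)
open import Data.Sum using (_⊎_; inj₁; inj₂)
open import Data.Empty using (⊥; ⊥-elim)
open import Data.Unit using (⊤; tt)
open import Data.Maybe using (Maybe; just; nothing)
open import Data.Maybe.Properties using (just-injective)
open import Relation.Nullary using (¬_; Stable; yes; no; does)
open import Relation.Nullary.Decidable using (decidable-stable)
open import Data.List.Properties using (length-++; length-reverse; unfold-reverse; length-take; take++drop≡id)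
open import Data.Bool.Properties using (∨-comm; ∨-identityʳ; ∧-zeroʳ; ∧-identityʳ)
open import Relation.Binary.PropositionalEquality
open import Function using (case_of_; _⇔_)
open import Function.Bundles using (mk⇔)
open import Data.Nat.Tactic.RingSolver using (solve-∀)
open import Algebra.Properties.CommutativeMonoid.Sum +-0-commutativeMonoid
  using (sum-cong-≗; ∑-distrib-+; ∑-comm; sum-replicate-zero) renaming (sum to ∑)
open import Algebra.Properties.Semiring.Sum +-*-semiring using (*-distribˡ-sum)
open import Data.Fin.Properties using (toℕ-injective) renaming (_≟_ to _≟ᶠ_)

t≢f : true ≡ false → ⊥
t≢f ()

⟦_⟧ : Bool → ℕ
⟦ true ⟧ = 1
⟦ false ⟧ = 0

⟦⟧≤1 : ∀ b → ⟦ b ⟧ ≤ 1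
⟦⟧≤1 true = s≤s z≤n
⟦⟧≤1 false = z≤n

⟦∧⟧ : ∀ b c → ⟦ b ∧ c ⟧ ≡ ⟦ b ⟧ * ⟦ c ⟧
⟦∧⟧ true c = sym (+-identityʳ ⟦ c ⟧)
⟦∧⟧ false c = refl

_==_ : ∀ {n} → Fin n → Fin n → Bool
fzero == fzero = true
fzero == fsuc y = false
fsuc x == fzero = false
fsuc x == fsuc y = x == y

==-refl : ∀ {n} (x : Fin n) → (x == x) ≡ true
==-refl fzero = refl
==-refl (fsuc x) = ==-refl x

==-true : ∀ {n} (x y : Fin n) → (x == y) ≡ true → x ≡ y
==-true fzero fzero e = refl
==-true fzero (fsuc y) ()
==-true (fsuc x) fzero ()
==-true (fsuc x) (fsuc y) e = cong fsuc (==-true x y e)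

==-false : ∀ {n} {x y : Fin n} → x ≢ y → (x == y) ≡ false
==-false {x = x} {y} ne with x == y in eq
... | true = ⊥-elim (ne (==-true x y eq))
... | false = refl

∑-mono : ∀ {n} {f g : Fin n → ℕ} → (∀ x → f x ≤ g x) → ∑ f ≤ ∑ g
∑-mono {zero} e = z≤n
∑-mono {suc n} e = +-mono-≤ (e fzero) (∑-mono (λ i → e (fsuc i)))

∑-* : ∀ {n} (c : ℕ) (f : Fin n → ℕ) → ∑ (λ x → c * f x) ≡ c * ∑ f
∑-* c f = sym (*-distribˡ-sum c f)

∑-*ʳ : ∀ {n} (c : ℕ) (f : Fin n → ℕ) → ∑ (λ x → f x * c) ≡ ∑ f * c
∑-*ʳ c f = trans (sum-cong-≗ (λ x → *-comm (f x) c)) (trans (∑-* c f) (*-comm c (∑ f)))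

∑-point : ∀ {n} (x₀ : Fin n) (f : Fin n → ℕ) → ∑ (λ x → ⟦ x == x₀ ⟧ * f x) ≡ f x₀
∑-point {suc n} fzero f = trans (cong (f fzero + 0 +_) (sum-replicate-zero n)) (trans (+-identityʳ _) (+-identityʳ _))
∑-point {suc n} (fsuc x₀) f = ∑-point x₀ (λ i → f (fsuc i))

∑-point-1 : ∀ {n} (x₀ : Fin n) → ∑ (λ x → ⟦ x == x₀ ⟧) ≡ 1
∑-point-1 x₀ = trans (sum-cong-≗ (λ x → sym (*-identityʳ ⟦ x == x₀ ⟧))) (∑-point x₀ (λ _ → 1))

term≤∑ : ∀ {n} (x₀ : Fin n) (f : Fin n → ℕ) → f x₀ ≤ ∑ f
term≤∑ {suc n} fzero f = m≤m+n _ _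
term≤∑ {suc n} (fsuc x₀) f = ≤-trans (term≤∑ x₀ (λ i → f (fsuc i))) (m≤n+m _ (f fzero))

∑-const : ∀ {n} (c : ℕ) → ∑ {n} (λ _ → c) ≡ n * c
∑-const {zero} c = refl
∑-const {suc n} c = cong (c +_) (∑-const {n} c)

∑⟦⟧≡0⇒false : ∀ {n} (b : Fin n → Bool) → ∑ (λ x → ⟦ b x ⟧) ≡ 0 → ∀ x → b x ≡ false
∑⟦⟧≡0⇒false b e x with b x in eq
... | false = refl
... | true = ⊥-elim (1+n≰n {0} (subst (λ z → 1 ≤ z) e (subst (_≤ ∑ (λ x → ⟦ b x ⟧)) (cong ⟦_⟧ eq) (term≤∑ x (λ x → ⟦ b x ⟧)))))

∑⟦⟧>0⇒∃ : ∀ {n} (b : Fin n → Bool) → 1 ≤ ∑ (λ x → ⟦ b x ⟧) → Σ[ x ∈ Fin n ] b x ≡ true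
∑⟦⟧>0⇒∃ {zero} b ()
∑⟦⟧>0⇒∃ {suc n} b h with b fzero in eq
... | true = fzero , eq
... | false = let (x , bx) = ∑⟦⟧>0⇒∃ (λ i → b (fsuc i)) h in fsuc x , bx

∑-mono-< : ∀ {n} {f g : Fin n → ℕ} (x₀ : Fin n) → (∀ x → f x ≤ g x) → f x₀ < g x₀ → ∑ f < ∑ g
∑-mono-< {suc n} fzero le lt = +-mono-<-≤ lt (∑-mono (λ i → le (fsuc i)))
∑-mono-< {suc n} (fsuc x₀) le lt = +-mono-≤-< (le fzero) (∑-mono-< x₀ (λ i → le (fsuc i)) lt)

∧-elimˡ : ∀ {b c} → (b ∧ c) ≡ true → b ≡ true
∧-elimˡ {true} e = refl
∧-elimʳ : ∀ {b c} → (b ∧ c) ≡ true → c ≡ true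
∧-elimʳ {true} e = e
∧-intro : ∀ {b c} → b ≡ true → c ≡ true → (b ∧ c) ≡ true
∧-intro refl refl = refl

two⇒∑⟦⟧≥2 : ∀ {n} (b : Fin n → Bool) (x y : Fin n) → x ≢ y → b x ≡ true → b y ≡ true → 2 ≤ ∑ (λ z → ⟦ b z ⟧)
two⇒∑⟦⟧≥2 b x y ne bx by = ≤-trans (≤-reflexive (cong₂ _+_ (sym (∑-point-1 x)) (sym (∑-point-1 y))))
   (≤-trans (≤-reflexive (sym (∑-distrib-+ (λ z → ⟦ z == x ⟧) (λ z → ⟦ z == y ⟧)))) (∑-mono pointwise))
  where
  pointwise : ∀ z → ⟦ z == x ⟧ + ⟦ z == y ⟧ ≤ ⟦ b z ⟧
  pointwise z with z == x in e1 | z == y in e2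
  ... | true | true = ⊥-elim (ne (trans (sym (==-true z x e1)) (==-true z y e2)))
  ... | true | false = ≤-reflexive (sym (cong ⟦_⟧ (subst (λ w → b w ≡ true) (sym (==-true z x e1)) bx)))
  ... | false | true = ≤-reflexive (sym (cong ⟦_⟧ (subst (λ w → b w ≡ true) (sym (==-true z y e2)) by)))
  ... | false | false = z≤n

∑⟦⟧≥2⇒two : ∀ {n} (b : Fin n → Bool) → 2 ≤ ∑ (λ z → ⟦ b z ⟧) → Σ[ x ∈ Fin n ] Σ[ y ∈ Fin n ] (x ≢ y × b x ≡ true × b y ≡ true)
∑⟦⟧≥2⇒two {n} b h with ∑⟦⟧>0⇒∃ b (≤-trans (s≤s z≤n) h)
... | x , bx with ∑⟦⟧>0⇒∃ (λ z → b z ∧ not (z == x)) (≤-pred two≤)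
  where
  pointwise : ∀ z → ⟦ b z ⟧ ≤ ⟦ z == x ⟧ + ⟦ b z ∧ not (z == x) ⟧
  pointwise z with b z | z == x
  ... | true | true = ≤-refl
  ... | true | false = ≤-refl
  ... | false | _ = z≤n
  two≤ : 2 ≤ 1 + ∑ (λ z → ⟦ b z ∧ not (z == x) ⟧)
  two≤ = ≤-trans h (≤-trans (∑-mono pointwise) (≤-reflexive (trans (∑-distrib-+ (λ z → ⟦ z == x ⟧) (λ z → ⟦ b z ∧ not (z == x) ⟧)) (cong (_+ ∑ (λ z → ⟦ b z ∧ not (z == x) ⟧)) (∑-point-1 x)))))
... | y , by = x , y , (λ e → ne e (∧-elimʳ by)) , bx , ∧-elimˡ by
  where
  ne : x ≡ y → not (y == x) ≡ true → ⊥
  ne refl e = case (x == x) (==-refl x) e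
    where
    case : ∀ c → c ≡ true → not c ≡ true → ⊥
    case true _ ()


infix 4 _∈ᵇ_
_∈ᵇ_ : ∀ {n} → Fin n → List (Fin n) → Bool
x ∈ᵇ [] = false
x ∈ᵇ (a ∷ L) = (x == a) ∨ (x ∈ᵇ L)

data Distinct {n} : List (Fin n) → Set where
  [] : Distinct []
  _∷_ : ∀ {x xs} → (x ∈ᵇ xs) ≡ false → Distinct xs → Distinct (x ∷ xs)

sumL : ∀ {n} → (Fin n → ℕ) → List (Fin n) → ℕ
sumL f [] = 0
sumL f (x ∷ xs) = f x + sumL f xs

∨-false : ∀ {b c} → (b ∨ c) ≡ false → b ≡ false × c ≡ false
∨-false {false} {false} e = refl , refl

∨-true : ∀ {b c} → (b ∨ c) ≡ true → b ≡ true ⊎ c ≡ true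
∨-true {true} e = inj₁ refl
∨-true {false} e = inj₂ e

∈-head : ∀ {n} (x : Fin n) xs → (x ∈ᵇ (x ∷ xs)) ≡ true
∈-head x xs rewrite ==-refl x = refl

∈-there : ∀ {n} (x a : Fin n) xs → (x ∈ᵇ xs) ≡ true → (x ∈ᵇ (a ∷ xs)) ≡ true
∈-there x a xs e rewrite e with x == a
... | true = refl
... | false = refl

∑-∈ᵇ : ∀ {n} (f : Fin n → ℕ) (L : List (Fin n)) → Distinct L → ∑ (λ x → ⟦ x ∈ᵇ L ⟧ * f x) ≡ sumL f L
∑-∈ᵇ {n} f [] d = sum-replicate-zero n
∑-∈ᵇ f (a ∷ L) (a∉ ∷ d) = trans (sum-cong-≗ pointwise) (trans (∑-distrib-+ (λ x → ⟦ x == a ⟧ * f x) (λ x → ⟦ x ∈ᵇ L ⟧ * f x))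
                             (cong₂ _+_ (∑-point a f) (∑-∈ᵇ f L d)))
  where
  pointwise : ∀ x → ⟦ x ∈ᵇ (a ∷ L) ⟧ * f x ≡ ⟦ x == a ⟧ * f x + ⟦ x ∈ᵇ L ⟧ * f x
  pointwise x with x == a in e
  ... | false = refl
  ... | true rewrite ==-true x a e | a∉ = sym (+-identityʳ _)

∑-∈ᵇ-length : ∀ {n} (L : List (Fin n)) → Distinct L → ∑ (λ x → ⟦ x ∈ᵇ L ⟧) ≡ length L
∑-∈ᵇ-length {n} L d = trans (sum-cong-≗ {n} (λ x → sym (*-identityʳ ⟦ x ∈ᵇ L ⟧))) (trans (∑-∈ᵇ (λ _ → 1) L d) (lenL L))
  where
  lenL : ∀ L → sumL (λ _ → 1) L ≡ length L
  lenL [] = refl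
  lenL (x ∷ L) = cong suc (lenL L)

∈-++ : ∀ {n} (x : Fin n) xs ys → (x ∈ᵇ (xs ++ ys)) ≡ ((x ∈ᵇ xs) ∨ (x ∈ᵇ ys))
∈-++ x [] ys = refl
∈-++ x (a ∷ xs) ys rewrite ∈-++ x xs ys with x == a
... | true = refl
... | false = refl

∈-reverse : ∀ {n} (x : Fin n) xs → (x ∈ᵇ reverse xs) ≡ (x ∈ᵇ xs)
∈-reverse x [] = refl
∈-reverse x (a ∷ xs) rewrite unfold-reverse a xs | ∈-++ x (reverse xs) (a ∷ []) | ∈-reverse x xs
  | ∨-identityʳ (x == a) = ∨-comm (x ∈ᵇ xs) (x == a)

Distinct-++ : ∀ {n} {xs ys : List (Fin n)} → Distinct xs → Distinct ys → (∀ x → (x ∈ᵇ xs) ≡ true → (x ∈ᵇ ys) ≡ false) → Distinct (xs ++ ys)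
Distinct-++ {xs = []} [] dy disj = dy
Distinct-++ {xs = a ∷ xs} {ys} (a∉ ∷ dx) dy disj =
  subst (_≡ false) (sym (∈-++ a xs ys)) (cong₂ _∨_ a∉ (disj a (∈-head a xs)) ) ∷ Distinct-++ dx dy (λ x e → disj x (∈-there x a xs e))

Distinct-++⁻ˡ : ∀ {n} (xs : List (Fin n)) {ys} → Distinct (xs ++ ys) → Distinct xs
Distinct-++⁻ˡ [] d = []
Distinct-++⁻ˡ (a ∷ xs) {ys} (a∉ ∷ d) = proj₁ (∨-false (trans (sym (∈-++ a xs ys)) a∉)) ∷ Distinct-++⁻ˡ xs d

Distinct-++⁻ʳ : ∀ {n} (xs : List (Fin n)) {ys} → Distinct (xs ++ ys) → Distinct ys
Distinct-++⁻ʳ [] d = d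
Distinct-++⁻ʳ (a ∷ xs) (a∉ ∷ d) = Distinct-++⁻ʳ xs d

Distinct-++⁻disj : ∀ {n} (xs : List (Fin n)) {ys} → Distinct (xs ++ ys) → ∀ x → (x ∈ᵇ xs) ≡ true → (x ∈ᵇ ys) ≡ false
Distinct-++⁻disj [] d x ()
Distinct-++⁻disj (a ∷ xs) {ys} (a∉ ∷ d) x e with x == a in ea
... | true rewrite ==-true x a ea = proj₂ (∨-false (trans (sym (∈-++ a xs ys)) a∉))
... | false = Distinct-++⁻disj xs d x e

Distinct-reverse : ∀ {n} (xs : List (Fin n)) → Distinct xs → Distinct (reverse xs)
Distinct-reverse [] d = d
Distinct-reverse (a ∷ xs) (a∉ ∷ d) rewrite unfold-reverse a xs =
  Distinct-++ (Distinct-reverse xs d) (refl ∷ []) (λ x e → a∉-single x (trans (sym (∈-reverse x xs)) e))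
  where
  a∉-single : ∀ x → (x ∈ᵇ xs) ≡ true → (x ∈ᵇ (a ∷ [])) ≡ false
  a∉-single x e with x == a in ea
  ... | true rewrite ==-true x a ea = ⊥-elim (t≢f (trans (sym e) a∉))
  ... | false = refl

last' : ∀ {A : Set} → A → List A → A
last' x [] = x
last' x (y ∷ ys) = last' y ys

lastM : ∀ {A : Set} → List A → Maybe A
lastM [] = nothing
lastM (x ∷ xs) = just (last' x xs)

lastM-++ : ∀ {A : Set} (xs : List A) y ys → lastM (xs ++ (y ∷ ys)) ≡ lastM (y ∷ ys)
lastM-++ [] y ys = refl
lastM-++ (x ∷ []) y ys = refl
lastM-++ (x ∷ x' ∷ xs) y ys = lastM-++ (x' ∷ xs) y ys

head-reverse : ∀ {A : Set} (xs : List A) → head (reverse xs) ≡ lastM xs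
head-reverse [] = refl
head-reverse (x ∷ []) = refl
head-reverse (x ∷ y ∷ xs) = begin
  head (reverse (x ∷ y ∷ xs))            ≡⟨ cong head (unfold-reverse x (y ∷ xs)) ⟩
  head (reverse (y ∷ xs) ++ (x ∷ []))    ≡⟨ cong (λ zs → head (zs ++ (x ∷ []))) (unfold-reverse y xs) ⟩
  head ((reverse xs ++ (y ∷ [])) ++ (x ∷ [])) ≡⟨ head-++-∷ʳ (reverse xs) ⟩
  head (reverse xs ++ (y ∷ []))          ≡⟨ cong head (unfold-reverse y xs) ⟨
  head (reverse (y ∷ xs))                ≡⟨ head-reverse (y ∷ xs) ⟩
  lastM (y ∷ xs)                         ∎
  where
  open ≡-Reasoning
  head-++-∷ʳ : ∀ zs {ws} → head ((zs ++ (y ∷ [])) ++ ws) ≡ head (zs ++ (y ∷ []))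
  head-++-∷ʳ [] = refl
  head-++-∷ʳ (z ∷ zs) = refl

lastM-reverse : ∀ {A : Set} (xs : List A) → lastM (reverse xs) ≡ head xs
lastM-reverse [] = refl
lastM-reverse (x ∷ xs) rewrite unfold-reverse x xs = lastM-++ (reverse xs) x []

module Chains {n} (R : Fin n → Fin n → Bool) where

  Chain : List (Fin n) → Set
  Chain [] = ⊤
  Chain (x ∷ []) = ⊤
  Chain (x ∷ y ∷ L) = (R x y ≡ true) × Chain (y ∷ L)

  Joins : Maybe (Fin n) → Maybe (Fin n) → Set
  Joins (just a) (just b) = R a b ≡ true
  Joins _ _ = ⊤

  chain-++ : ∀ xs ys → Chain xs → Chain ys → Joins (lastM xs) (head ys) → Chain (xs ++ ys)
  chain-++ [] ys cx cy j = cy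
  chain-++ (x ∷ []) [] cx cy j = tt
  chain-++ (x ∷ []) (y ∷ ys) cx cy j = j , cy
  chain-++ (x ∷ x' ∷ xs) ys (r , cx) cy j = r , chain-++ (x' ∷ xs) ys cx cy j

  chain-++⁻ˡ : ∀ xs ys → Chain (xs ++ ys) → Chain xs
  chain-++⁻ˡ [] ys c = tt
  chain-++⁻ˡ (x ∷ []) ys c = tt
  chain-++⁻ˡ (x ∷ x' ∷ xs) ys (r , c) = r , chain-++⁻ˡ (x' ∷ xs) ys c

  chain-++⁻ʳ : ∀ xs ys → Chain (xs ++ ys) → Chain ys
  chain-++⁻ʳ [] ys c = c
  chain-++⁻ʳ (x ∷ []) [] c = tt
  chain-++⁻ʳ (x ∷ []) (y ∷ ys) (r , c) = c
  chain-++⁻ʳ (x ∷ x' ∷ xs) ys (r , c) = chain-++⁻ʳ (x' ∷ xs) ys c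

  chain-reverse : (∀ a b → R a b ≡ R b a) → ∀ xs → Chain xs → Chain (reverse xs)
  chain-reverse s [] c = tt
  chain-reverse s (x ∷ []) c = tt
  chain-reverse s (x ∷ y ∷ xs) (r , c) = subst Chain (sym (unfold-reverse x (y ∷ xs)))
    (chain-++ (reverse (y ∷ xs)) (x ∷ []) (chain-reverse s (y ∷ xs) c) tt
      (subst (λ m → Joins m (just x)) (sym (lastM-reverse (y ∷ xs))) (trans (s y x) r)))

  chain-take : ∀ m xs → Chain xs → Chain (take m xs)
  chain-take zero xs c = tt
  chain-take (suc m) [] c = tt
  chain-take (suc zero) (x ∷ xs) c = tt
  chain-take (suc (suc m)) (x ∷ []) c = tt
  chain-take (suc (suc m)) (x ∷ y ∷ xs) (r , c) = r , chain-take (suc m) (y ∷ xs) c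

  chain-clique : ∀ xs → (∀ x y → (x ∈ᵇ xs) ≡ true → (y ∈ᵇ xs) ≡ true → x ≢ y → R x y ≡ true) → Distinct xs → Chain xs
  chain-clique [] cl d = tt
  chain-clique (x ∷ []) cl d = tt
  chain-clique (x ∷ y ∷ xs) cl (x∉ ∷ d) =
    cl x y (∈-head x (y ∷ xs)) (∈-there y x (y ∷ xs) (∈-head y xs)) neq
    , chain-clique (y ∷ xs) (λ p q pi qi → cl p q (∈-there p x (y ∷ xs) pi) (∈-there q x (y ∷ xs) qi)) d
    where
    neq : x ≢ y
    neq refl = t≢f (trans (sym (==-refl x)) (proj₁ (∨-false x∉)))

fins : ∀ n → List (Fin n)
fins zero = []
fins (suc n) = fzero ∷ map fsuc (fins n)

∈-map-suc : ∀ {n} (z : Fin n) L → (fsuc z ∈ᵇ map fsuc L) ≡ (z ∈ᵇ L)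
∈-map-suc z [] = refl
∈-map-suc z (a ∷ L) = cong ((z == a) ∨_) (∈-map-suc z L)

∈-map-zero : ∀ {n} (L : List (Fin n)) → (fzero ∈ᵇ map fsuc L) ≡ false
∈-map-zero [] = refl
∈-map-zero (a ∷ L) = ∈-map-zero L

∈-fins : ∀ {n} (z : Fin n) → (z ∈ᵇ fins n) ≡ true
∈-fins fzero = refl
∈-fins {suc n} (fsuc z) = trans (∈-map-suc z (fins n)) (∈-fins z)

Distinct-map-suc : ∀ {n} (L : List (Fin n)) → Distinct L → Distinct (map fsuc L)
Distinct-map-suc [] d = []
Distinct-map-suc (a ∷ L) (a∉ ∷ d) = trans (∈-map-suc a L) a∉ ∷ Distinct-map-suc L d

Distinct-fins : ∀ n → Distinct (fins n)
Distinct-fins zero = []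
Distinct-fins (suc n) = ∈-map-zero (fins n) ∷ Distinct-map-suc (fins n) (Distinct-fins n)

∈-filterᵇ : ∀ {n} (p : Fin n → Bool) z L → (z ∈ᵇ filterᵇ p L) ≡ (p z ∧ (z ∈ᵇ L))
∈-filterᵇ p z [] with p z
... | true = refl
... | false = refl
∈-filterᵇ p z (x ∷ xs) with p x in px
... | true = trans (cong ((z == x) ∨_) (∈-filterᵇ p z xs)) (bool-identity (z == x) refl)
  where
  bool-identity : ∀ b → (z == x) ≡ b → (b ∨ (p z ∧ (z ∈ᵇ xs))) ≡ (p z ∧ (b ∨ (z ∈ᵇ xs)))
  bool-identity true e rewrite ==-true z x e | px = refl
  bool-identity false e with p z
  ... | true = refl
  ... | false = refl
... | false = trans (∈-filterᵇ p z xs) (bool-identity (z == x) refl)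
  where
  bool-identity : ∀ b → (z == x) ≡ b → (p z ∧ (z ∈ᵇ xs)) ≡ (p z ∧ (b ∨ (z ∈ᵇ xs)))
  bool-identity true e rewrite ==-true z x e | px = refl
  bool-identity false e = refl

Distinct-filterᵇ : ∀ {n} (p : Fin n → Bool) L → Distinct L → Distinct (filterᵇ p L)
Distinct-filterᵇ p [] d = []
Distinct-filterᵇ p (x ∷ xs) (x∉ ∷ d) with p x
... | true = trans (∈-filterᵇ p x xs) (trans (cong (p x ∧_) x∉) (∧-zeroʳ (p x))) ∷ Distinct-filterᵇ p xs d
... | false = Distinct-filterᵇ p xs d

length-filterᵇ : ∀ {n} (p : Fin n → Bool) L → length (filterᵇ p L) ≡ sumL (λ z → ⟦ p z ⟧) L
length-filterᵇ p [] = refl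
length-filterᵇ p (x ∷ xs) with p x
... | true = cong suc (length-filterᵇ p xs)
... | false = length-filterᵇ p xs

length-filterᵇ-fins : ∀ {n} (p : Fin n → Bool) → length (filterᵇ p (fins n)) ≡ ∑ (λ z → ⟦ p z ⟧)
length-filterᵇ-fins {n} p = trans (length-filterᵇ p (fins n)) (trans (sym (∑-∈ᵇ (λ z → ⟦ p z ⟧) (fins n) (Distinct-fins n)))
   (sum-cong-≗ (λ z → trans (cong (λ b → ⟦ b ⟧ * ⟦ p z ⟧) (∈-fins z)) (+-identityʳ _))))

∈-filterᵇ-fins : ∀ {n} (p : Fin n → Bool) z → (z ∈ᵇ filterᵇ p (fins n)) ≡ p z
∈-filterᵇ-fins p z rewrite ∈-filterᵇ p z (fins _) | ∈-fins z with p z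
... | true = refl
... | false = refl

∈-split : ∀ {n} (x : Fin n) L → (x ∈ᵇ L) ≡ true → Σ[ A ∈ List (Fin n) ] Σ[ B ∈ List (Fin n) ] L ≡ A ++ (x ∷ B)
∈-split x [] ()
∈-split x (a ∷ L) e with x == a in ea
... | true rewrite ==-true x a ea = [] , L , refl
... | false = let (A , B , eq) = ∈-split x L e in a ∷ A , B , cong (a ∷_) eq

last∈ : ∀ {n} (x : Fin n) xs → (last' x xs ∈ᵇ (x ∷ xs)) ≡ true
last∈ x [] = ∈-head x []
last∈ x (y ∷ xs) = ∈-there _ x (y ∷ xs) (last∈ y xs)

head-++ : ∀ {A : Set} (xs ys : List A) (z : A) → head xs ≡ just z → head (xs ++ ys) ≡ just z
head-++ (x ∷ xs) ys z e = e

lastM-++' : ∀ {A : Set} (xs ys : List A) (z : A) → lastM ys ≡ just z → lastM (xs ++ ys) ≡ just z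
lastM-++' xs (y ∷ ys) z e = trans (lastM-++ xs y ys) e

∑-≡0 : ∀ {n} (f : Fin n → ℕ) → (∀ x → f x ≡ 0) → ∑ f ≡ 0
∑-≡0 {zero} f e = refl
∑-≡0 {suc n} f e rewrite e fzero = ∑-≡0 (λ i → f (fsuc i)) (λ i → e (fsuc i))

∑∑-≡0 : ∀ {n m} (f : Fin n → Fin m → ℕ) → (∀ x y → f x y ≡ 0) → ∑ (λ x → ∑ (λ y → f x y)) ≡ 0
∑∑-≡0 f e = ∑-≡0 (λ x → ∑ (λ y → f x y)) (λ x → ∑-≡0 (f x) (e x))

length-filterᵇ-tabulate : ∀ {n} {A : Set} (p : A → Bool) (f : Fin n → A) → length (filterᵇ p (tabulate f)) ≡ ∑ (λ i → ⟦ p (f i) ⟧)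
length-filterᵇ-tabulate {zero} p f = refl
length-filterᵇ-tabulate {suc n} p f with p (f fzero)
... | true = cong suc (length-filterᵇ-tabulate p (λ i → f (fsuc i)))
... | false = length-filterᵇ-tabulate p (λ i → f (fsuc i))

sum-map-tabulate : ∀ {n} {A : Set} (g : A → ℕ) (f : Fin n → A) → sum (map g (tabulate f)) ≡ ∑ (λ i → g (f i))
sum-map-tabulate {zero} g f = refl
sum-map-tabulate {suc n} g f = cong (g (f fzero) +_) (sum-map-tabulate g (λ i → f (fsuc i)))


module PathFunction {n} (R : Fin n → Fin n → Bool) where
  open Chains R

  toPath : ∀ m (x : Fin n) (xs : List (Fin n)) → length xs ≡ m → Fin (suc m) → Fin n
  toPath zero x [] e i = x
  toPath zero x (y ∷ ys) () i
  toPath (suc m) x [] () i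
  toPath (suc m) x (y ∷ ys) e fzero = x
  toPath (suc m) x (y ∷ ys) e (fsuc i) = toPath m y ys (suc-injective e) i

  toPath-0 : ∀ m x xs e → toPath m x xs e fzero ≡ x
  toPath-0 zero x [] e = refl
  toPath-0 (suc m) x (y ∷ ys) e = refl
  toPath-0 zero x (y ∷ ys) ()
  toPath-0 (suc m) x [] ()

  toPath-∈ : ∀ m x xs e i → (toPath m x xs e i ∈ᵇ (x ∷ xs)) ≡ true
  toPath-∈ zero x [] e i = ∈-head x []
  toPath-∈ (suc m) x (y ∷ ys) e fzero = ∈-head x (y ∷ ys)
  toPath-∈ zero x (y ∷ ys) () i
  toPath-∈ (suc m) x [] () i
  toPath-∈ (suc m) x (y ∷ ys) e (fsuc i) = ∈-there _ x (y ∷ ys) (toPath-∈ m y ys (suc-injective e) i)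

  toPath-injective : ∀ m x xs e → Distinct (x ∷ xs) → ∀ i j → toPath m x xs e i ≡ toPath m x xs e j → i ≡ j
  toPath-injective zero x [] e d fzero fzero eq = refl
  toPath-injective (suc m) x (y ∷ ys) e d fzero fzero eq = refl
  toPath-injective zero x (y ∷ ys) () d i j eq
  toPath-injective (suc m) x [] () d i j eq
  toPath-injective (suc m) x (y ∷ ys) e (x∉ ∷ d) fzero (fsuc j) eq =
    ⊥-elim (t≢f (trans (sym (toPath-∈ m y ys (suc-injective e) j)) (subst (λ z → (z ∈ᵇ (y ∷ ys)) ≡ false) eq x∉)))
  toPath-injective (suc m) x (y ∷ ys) e (x∉ ∷ d) (fsuc i) fzero eq =
    ⊥-elim (t≢f (trans (sym (toPath-∈ m y ys (suc-injective e) i)) (subst (λ z → (z ∈ᵇ (y ∷ ys)) ≡ false) (sym eq) x∉)))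
  toPath-injective (suc m) x (y ∷ ys) e (x∉ ∷ d) (fsuc i) (fsuc j) eq = cong fsuc (toPath-injective m y ys (suc-injective e) d i j eq)

  toPath-adjacent : ∀ m x xs e → Chain (x ∷ xs) → ∀ (i : Fin m) → R (toPath m x xs e (inject₁ i)) (toPath m x xs e (fsuc i)) ≡ true
  toPath-adjacent (suc m) x (y ∷ ys) e (r , c) fzero = subst (λ z → R x z ≡ true) (sym (toPath-0 m y ys (suc-injective e))) r
  toPath-adjacent (suc m) x (y ∷ ys) e (r , c) (fsuc i) = toPath-adjacent m y ys (suc-injective e) c i
  toPath-adjacent (suc m) x [] () c i

  toPath-last : ∀ m x xs e → toPath m x xs e (fromℕ m) ≡ last' x xs
  toPath-last zero x [] e = refl
  toPath-last (suc m) x (y ∷ ys) e = toPath-last m y ys (suc-injective e)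
  toPath-last zero x (y ∷ ys) ()
  toPath-last (suc m) x [] ()

-- Excluded middle is available for P because the goal A, an inequality of naturals in all uses, is stable.
by-cases : ∀ {A : Set} (P : Set) → Stable A → (P ⊎ ¬ P → A) → A
by-cases P st f = st (λ na → na (f (inj₂ (λ p → na (f (inj₁ p))))))

stable-× : ∀ {A B : Set} → Stable A → Stable B → Stable (A × B)
stable-× sa sb nn = sa (λ na → nn (λ p → na (proj₁ p))) , sb (λ nb → nn (λ p → nb (proj₂ p)))

stable-→ : ∀ {A B : Set} → Stable B → Stable (A → B)
stable-→ sb nn a = sb (λ nb → nn (λ f → nb (f a)))

absorb-surplus : ∀ {M} A B e d → A ≡ B + 1 → d ≡ 0 → suc e ≤ M → A + (e + d) ≤ B + M
absorb-surplus _ B e _ refl refl h = ≤-trans (≤-reflexive (shift B e)) (+-monoʳ-≤ B h)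
  where
  shift : ∀ B e → (B + 1) + (e + 0) ≡ B + suc e
  shift = solve-∀

absorb-surplus′ : ∀ {M} A B e d → A ≡ B + 0 → d ≡ 1 → suc e ≤ M → A + (e + d) ≤ B + M
absorb-surplus′ _ B e _ refl refl h = ≤-trans (≤-reflexive (shift B e)) (+-monoʳ-≤ B h)
  where
  shift : ∀ B e → (B + 0) + (e + 1) ≡ B + suc e
  shift = solve-∀

absorb-surplus-left : ∀ {M} A B e d → suc A ≤ B → d ≡ 1 → e ≤ M → A + (e + d) ≤ B + M
absorb-surplus-left A B e _ A<B refl h = ≤-trans (≤-reflexive (shift A e)) (+-mono-≤ A<B h)
  where
  shift : ∀ A e → A + (e + 1) ≡ suc A + e
  shift = solve-∀

absorb-strict : ∀ {M} A B e d → A ≤ B → d ≡ 0 → suc e ≤ M → suc (A + (e + d)) ≤ B + M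
absorb-strict A B e _ A≤B refl h = ≤-trans (≤-reflexive (shift A e)) (+-mono-≤ A≤B h)
  where
  shift : ∀ A e → suc (A + (e + 0)) ≡ A + suc e
  shift = solve-∀

module Proof {n} (G : Graph n) (v : Fin n) (k' : ℕ) (noPath : ¬ HasPathAvoidingEnds G v (2 * suc k')) where
  k : ℕ
  k = suc k'
  2k-1 : ℕ
  2k-1 = 2 * k ∸ 1

  a : Fin n → Fin n → Bool
  a = adj G
  asym : ∀ x y → a x y ≡ a y x
  asym = gsym G
  airr : ∀ x → a x x ≡ false
  airr = irrefl G
  open Chains a
  open PathFunction a

  VSet : Set
  VSet = Fin n → Bool

  deg : VSet → Fin n → ℕ
  deg U x = ∑ (λ y → ⟦ U y ∧ a x y ⟧)
  doubleEdges : VSet → ℕ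
  doubleEdges U = ∑ (λ x → ∑ (λ y → ⟦ U x ∧ (U y ∧ a x y) ⟧))
  dᵥ : VSet → ℕ
  dᵥ U = ∑ (λ x → ⟦ U x ∧ a x v ⟧)
  weight : VSet → ℕ
  weight U = doubleEdges U + dᵥ U
  size : VSet → ℕ
  size U = ∑ (λ x → ⟦ U x ⟧)

  a≢ : ∀ {x y} → a x y ≡ true → x ≢ y
  a≢ {x} e refl = t≢f (trans (sym e) (airr x))

  no-forbidden-path : ∀ x xs → Distinct (x ∷ xs) → Chain (x ∷ xs) → length xs ≡ 2 * k → x ≢ v → last' x xs ≢ v → ⊥
  no-forbidden-path x xs d c e x≢v l≢v =
    noPath (toPath (2 * k) x xs e
           , (λ {i} {j} eq → toPath-injective (2 * k) x xs e d i j eq)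
           , toPath-adjacent (2 * k) x xs e c
           , subst (_≢ v) (sym (toPath-0 (2 * k) x xs e)) x≢v
           , subst (_≢ v) (sym (toPath-last (2 * k) x xs e)) l≢v)

  no-forbidden-path′ : ∀ L → Distinct L → Chain L → length L ≡ suc (2 * k) → (∀ z → head L ≡ just z → z ≢ v) → (∀ z → lastM L ≡ just z → z ≢ v) → ⊥
  no-forbidden-path′ (x ∷ xs) d c e h l = no-forbidden-path x xs d c (suc-injective e) (h x refl) (l (last' x xs) refl)

  take∈ : ∀ m (z : Fin n) rest → (z ∈ᵇ take m rest) ≡ true → (z ∈ᵇ rest) ≡ true
  take∈ m z rest e = subst (λ L → (z ∈ᵇ L) ≡ true) (take++drop≡id m rest)
     (trans (∈-++ z (take m rest) (drop m rest)) (cong (_∨ (z ∈ᵇ drop m rest)) e))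

  2k-1≢0 : 2k-1 ≡ 0 → ⊥
  2k-1≢0 e = 1+n≢0 (trans (sym (+-suc k' (k' + 0))) e)

  no-long-path-from-edge : ∀ x y rest → Distinct (x ∷ y ∷ rest) → Chain (x ∷ y ∷ rest) → x ≢ v
           → (∀ z → (z ∈ᵇ rest) ≡ true → z ≢ v) → 2k-1 ≤ length rest → ⊥
  no-long-path-from-edge x y rest d c x≢v rv len = go (take 2k-1 rest) refl
    where
    lenT : length (take 2k-1 rest) ≡ 2k-1
    lenT = trans (length-take 2k-1 rest) (m≤n⇒m⊓n≡m len)
    full : (x ∷ y ∷ take 2k-1 rest) ++ drop 2k-1 rest ≡ x ∷ y ∷ rest
    full = cong (λ L → x ∷ y ∷ L) (take++drop≡id 2k-1 rest)
    go : ∀ L → take 2k-1 rest ≡ L → ⊥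
    go [] et = 2k-1≢0 (trans (sym lenT) (cong length et))
    go (r ∷ rs) et = no-forbidden-path x (y ∷ r ∷ rs) dd cc ll x≢v lv
      where
      dd : Distinct (x ∷ y ∷ r ∷ rs)
      dd = subst (λ L → Distinct (x ∷ y ∷ L)) et (Distinct-++⁻ˡ (x ∷ y ∷ take 2k-1 rest) (subst Distinct (sym full) d))
      cc : Chain (x ∷ y ∷ r ∷ rs)
      cc = subst (λ L → Chain (x ∷ y ∷ L)) et (chain-take (suc (suc 2k-1)) (x ∷ y ∷ rest) c)
      ll : length (y ∷ r ∷ rs) ≡ 2 * k
      ll = cong suc (trans (cong length (sym et)) lenT)
      lv : last' r rs ≢ v
      lv = rv (last' r rs) (take∈ 2k-1 _ rest (subst (λ L → (last' r rs ∈ᵇ L) ≡ true) (sym et) (last∈ r rs)))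
  ⟦∧∧⟧-split : ∀ ux wx uy wy axy → (wx ≡ true → ux ≡ true) → (wy ≡ true → uy ≡ true) →
    ⟦ ux ∧ (uy ∧ axy) ⟧ ≡ (⟦ (ux ∧ not wx) ∧ ((uy ∧ not wy) ∧ axy) ⟧ + ⟦ wx ∧ (wy ∧ axy) ⟧) + (⟦ wx ∧ ((uy ∧ not wy) ∧ axy) ⟧ + ⟦ wy ∧ ((ux ∧ not wx) ∧ axy) ⟧)
  ⟦∧∧⟧-split false true _ _ _ w⊆u _ = ⊥-elim (t≢f (sym (w⊆u refl)))
  ⟦∧∧⟧-split _ _ false true _ _ w⊆u = ⊥-elim (t≢f (sym (w⊆u refl)))
  ⟦∧∧⟧-split true true true true true _ _ = refl
  ⟦∧∧⟧-split true true true true false _ _ = refl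
  ⟦∧∧⟧-split true true true false true _ _ = refl
  ⟦∧∧⟧-split true true true false false _ _ = refl
  ⟦∧∧⟧-split true true false false _ _ _ = refl
  ⟦∧∧⟧-split true false true true true _ _ = refl
  ⟦∧∧⟧-split true false true true false _ _ = refl
  ⟦∧∧⟧-split true false true false true _ _ = refl
  ⟦∧∧⟧-split true false true false false _ _ = refl
  ⟦∧∧⟧-split true false false false _ _ _ = refl
  ⟦∧∧⟧-split false false true true _ _ _ = refl
  ⟦∧∧⟧-split false false true false _ _ _ = refl
  ⟦∧∧⟧-split false false false false _ _ _ = refl

  _⊆_ : VSet → VSet → Set
  W ⊆ U = ∀ x → W x ≡ true → U x ≡ true

  _∖_ : VSet → VSet → VSet
  (U ∖ W) x = U x ∧ not (W x)

  Closed : VSet → VSet → Set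
  Closed U W = ∀ x y → W x ≡ true → (U ∖ W) y ≡ true → a x y ≡ false

  cross : VSet → VSet → ℕ
  cross W U' = ∑ (λ x → ∑ (λ y → ⟦ W x ∧ (U' y ∧ a x y) ⟧))

  doubleEdges-∖ : ∀ U W → W ⊆ U →
    doubleEdges U ≡ (doubleEdges (U ∖ W) + doubleEdges W) + (cross W (U ∖ W) + cross W (U ∖ W))
  doubleEdges-∖ U W sub =
    trans (sum-cong-≗ (λ x → sum-cong-≗ (λ y → ⟦∧∧⟧-split (U x) (W x) (U y) (W y) (a x y) (sub x) (sub y))))
    (trans (sum-cong-≗ (λ x → ∑-distrib-+ (λ y → A x y + B x y) (λ y → C x y + D x y)))
    (trans (∑-distrib-+ (λ x → ∑ (λ y → A x y + B x y)) (λ x → ∑ (λ y → C x y + D x y)))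
    (cong₂ _+_
      (trans (sum-cong-≗ (λ x → ∑-distrib-+ (A x) (B x))) (∑-distrib-+ (λ x → ∑ (A x)) (λ x → ∑ (B x))))
      (trans (sum-cong-≗ (λ x → ∑-distrib-+ (C x) (D x))) (trans (∑-distrib-+ (λ x → ∑ (C x)) (λ x → ∑ (D x))) (cong (cross W (U ∖ W) +_) swp))))))
    where
    U' = (U ∖ W)
    A B C D : Fin n → Fin n → ℕ
    A x y = ⟦ (U x ∧ not (W x)) ∧ ((U y ∧ not (W y)) ∧ a x y) ⟧
    B x y = ⟦ W x ∧ (W y ∧ a x y) ⟧
    C x y = ⟦ W x ∧ ((U y ∧ not (W y)) ∧ a x y) ⟧
    D x y = ⟦ W y ∧ ((U x ∧ not (W x)) ∧ a x y) ⟧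
    swp : ∑ (λ x → ∑ (λ y → D x y)) ≡ cross W U'
    swp = trans (∑-comm D)
          (sum-cong-≗ (λ x → sum-cong-≗ (λ y → cong (λ b → ⟦ W x ∧ (U' y ∧ b) ⟧) (asym y x))))

  ⟦∧⟧-split : ∀ ux wx b → (wx ≡ true → ux ≡ true) → ⟦ ux ∧ b ⟧ ≡ ⟦ (ux ∧ not wx) ∧ b ⟧ + ⟦ wx ∧ b ⟧
  ⟦∧⟧-split true true true h = refl
  ⟦∧⟧-split true true false h = refl
  ⟦∧⟧-split true false true h = refl
  ⟦∧⟧-split true false false h = refl
  ⟦∧⟧-split false true b h = ⊥-elim (t≢f (sym (h refl)))
  ⟦∧⟧-split false false b h = refl

  dᵥ-∖ : ∀ U W → W ⊆ U → dᵥ U ≡ dᵥ (U ∖ W) + dᵥ W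
  dᵥ-∖ U W sub = trans (sum-cong-≗ (λ x → ⟦∧⟧-split (U x) (W x) (a x v) (sub x))) (∑-distrib-+ (λ x → ⟦ (U x ∧ not (W x)) ∧ a x v ⟧) (λ x → ⟦ W x ∧ a x v ⟧))

  size-∖ : ∀ U W → W ⊆ U → size U ≡ size (U ∖ W) + size W
  size-∖ U W sub = trans (sum-cong-≗ (λ x → trans (cong ⟦_⟧ (sym (∧-identityʳ (U x)))) (trans (⟦∧⟧-split (U x) (W x) true (sub x))
      (cong₂ _+_ (cong ⟦_⟧ (∧-identityʳ (U x ∧ not (W x)))) (cong ⟦_⟧ (∧-identityʳ (W x))))))) (∑-distrib-+ (λ x → ⟦ U x ∧ not (W x) ⟧) (λ x → ⟦ W x ⟧))

  weight-∖ : ∀ U W → W ⊆ U →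
    weight U ≡ weight (U ∖ W) + (((cross W (U ∖ W) + cross W (U ∖ W)) + doubleEdges W) + dᵥ W)
  weight-∖ U W sub = trans (cong₂ _+_ (doubleEdges-∖ U W sub) (dᵥ-∖ U W sub)) 
    (rearrange (doubleEdges (U ∖ W)) (doubleEdges W) (cross W (U ∖ W)) (dᵥ (U ∖ W)) (dᵥ W))
    where
    rearrange : ∀ e₁ e₂ c d₁ d₂ → ((e₁ + e₂) + (c + c)) + (d₁ + d₂) ≡ (e₁ + d₁) + (((c + c) + e₂) + d₂)
    rearrange = solve-∀

  ⁅_⁆ : Fin n → VSet
  ⁅ x₀ ⁆ z = z == x₀

  ⁅⁆⊆ : ∀ (U : VSet) x₀ → U x₀ ≡ true → ⁅ x₀ ⁆ ⊆ U
  ⁅⁆⊆ U x₀ ux x e rewrite ==-true x x₀ e = ux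

  doubleEdges-⁅⁆ : ∀ x₀ → doubleEdges ⁅ x₀ ⁆ ≡ 0
  doubleEdges-⁅⁆ x₀ = ∑∑-≡0 (λ x y → ⟦ (x == x₀) ∧ ((y == x₀) ∧ a x y) ⟧) pointwise
    where
    pointwise : ∀ x y → ⟦ (x == x₀) ∧ ((y == x₀) ∧ a x y) ⟧ ≡ 0
    pointwise x y with x == x₀ in e1 | y == x₀ in e2
    ... | true | true rewrite ==-true x x₀ e1 | ==-true y x₀ e2 | airr x₀ = refl
    ... | true | false = refl
    ... | false | _ = refl

  cross-⁅⁆ : ∀ x₀ U' → cross ⁅ x₀ ⁆ U' ≡ deg U' x₀
  cross-⁅⁆ x₀ U' = trans (∑-comm (λ x y → ⟦ (x == x₀) ∧ (U' y ∧ a x y) ⟧))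
     (sum-cong-≗ (λ y → trans (sum-cong-≗ (λ x → ⟦∧⟧ (x == x₀) (U' y ∧ a x y))) (trans (∑-point x₀ (λ x → ⟦ U' y ∧ a x y ⟧)) refl)))

  dᵥ-⁅⁆ : ∀ x₀ → dᵥ ⁅ x₀ ⁆ ≡ ⟦ a x₀ v ⟧
  dᵥ-⁅⁆ x₀ = trans (sum-cong-≗ (λ x → ⟦∧⟧ (x == x₀) (a x v))) (∑-point x₀ (λ x → ⟦ a x v ⟧))

  size-⁅⁆ : ∀ x₀ → size ⁅ x₀ ⁆ ≡ 1
  size-⁅⁆ x₀ = ∑-point-1 x₀

  deg-∖⁅⁆ : ∀ U x₀ → deg U x₀ ≡ deg (U ∖ ⁅ x₀ ⁆) x₀
  deg-∖⁅⁆ U x₀ = sum-cong-≗ pointwise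
    where
    pointwise : ∀ y → ⟦ U y ∧ a x₀ y ⟧ ≡ ⟦ (U y ∧ not (y == x₀)) ∧ a x₀ y ⟧
    pointwise y with y == x₀ in e
    ... | true rewrite ==-true y x₀ e | airr x₀ = bool-identity (U x₀)
      where
      bool-identity : ∀ b → ⟦ b ∧ false ⟧ ≡ ⟦ (b ∧ false) ∧ false ⟧
      bool-identity true = refl
      bool-identity false = refl
    ... | false = cong ⟦_⟧ (bool-identity (U y))
      where
      bool-identity : ∀ b → (b ∧ a x₀ y) ≡ ((b ∧ true) ∧ a x₀ y)
      bool-identity true = refl
      bool-identity false = refl

  weight-∖⁅⁆ : ∀ U x₀ → U x₀ ≡ true → weight U ≡ weight (U ∖ ⁅ x₀ ⁆) + ((deg U x₀ + deg U x₀) + ⟦ a x₀ v ⟧)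
  weight-∖⁅⁆ U x₀ ux = trans (weight-∖ U ⁅ x₀ ⁆ (⁅⁆⊆ U x₀ ux))
     (cong (weight (U ∖ ⁅ x₀ ⁆) +_) (cong₂ _+_ (trans (cong₂ _+_ (cong₂ _+_ c c) (doubleEdges-⁅⁆ x₀)) (+-identityʳ (deg U x₀ + deg U x₀))) (dᵥ-⁅⁆ x₀)))
    where
    c : cross ⁅ x₀ ⁆ (U ∖ ⁅ x₀ ⁆) ≡ deg U x₀
    c = trans (cross-⁅⁆ x₀ _) (sym (deg-∖⁅⁆ U x₀))

  cross-closed : ∀ U W → Closed U W → cross W (U ∖ W) ≡ 0
  cross-closed U W cl = ∑∑-≡0 (λ x y → ⟦ W x ∧ ((U ∖ W) y ∧ a x y) ⟧) pointwise
    where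
    pointwise : ∀ x y → ⟦ W x ∧ ((U ∖ W) y ∧ a x y) ⟧ ≡ 0
    pointwise x y with W x in e1 | (U ∖ W) y in e2
    ... | true | true rewrite cl x y e1 e2 = refl
    ... | true | false = refl
    ... | false | _ = refl

  weight-∖-closed : ∀ U W → W ⊆ U → Closed U W →
    weight U ≡ weight (U ∖ W) + (doubleEdges W + dᵥ W)
  weight-∖-closed U W sub cl rewrite weight-∖ U W sub | cross-closed U W cl = refl

  ≡ᵇ-true⇒≡ : ∀ m n → (m ≡ᵇ n) ≡ true → m ≡ n
  ≡ᵇ-true⇒≡ zero zero e = refl
  ≡ᵇ-true⇒≡ (suc m) (suc n) e = cong suc (≡ᵇ-true⇒≡ m n e)
  ≡ᵇ-true⇒≡ zero (suc n) ()
  ≡ᵇ-true⇒≡ (suc m) zero ()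

  ≡ᵇ-refl : ∀ m → (m ≡ᵇ m) ≡ true
  ≡ᵇ-refl zero = refl
  ≡ᵇ-refl (suc m) = ≡ᵇ-refl m

  All∈ : VSet → List (Fin n) → Set
  All∈ S L = ∀ z → (z ∈ᵇ L) ≡ true → S z ≡ true

  All∈-∉ : ∀ (S : VSet) L x → All∈ S L → S x ≡ false → (x ∈ᵇ L) ≡ false
  All∈-∉ S L x al sx with x ∈ᵇ L in e
  ... | true = ⊥-elim (t≢f (trans (sym (al x e)) sx))
  ... | false = refl

  record Exceptional (j : ℕ) (U : VSet) : Set where
    field
      c : Fin n → ℕ
      adjacent⇒same : ∀ x y → U x ≡ true → U y ≡ true → a x y ≡ true → c x ≡ c y
      same⇒adjacent : ∀ x y → U x ≡ true → U y ≡ true → x ≢ y → c x ≡ c y → a x y ≡ true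
      class-size : ∀ x → U x ≡ true → ∑ (λ y → ⟦ U y ∧ (c y ≡ᵇ c x) ⟧) ≡ 2 * k
      v-degree : dᵥ U ≡ j

  module ExceptionalProperties {j U} (ex : Exceptional j U) where
    open Exceptional ex

    deg+1≡class : ∀ x → U x ≡ true → ∀ y → ⟦ U y ∧ a x y ⟧ + ⟦ y == x ⟧ ≡ ⟦ U y ∧ (c y ≡ᵇ c x) ⟧
    deg+1≡class x ux y with y == x in e
    ... | true rewrite ==-true y x e | airr x | ux | ≡ᵇ-refl (c x) = refl
    ... | false with U y in uy
    ...   | false = refl
    ...   | true with a x y in axy
    ...     | true rewrite adjacent⇒same x y ux uy axy | ≡ᵇ-refl (c y) = refl
    ...     | false with c y ≡ᵇ c x in ceq
    ...       | false = refl
    ...       | true = ⊥-elim (t≢f (trans (sym (same⇒adjacent x y ux uy (λ xy → t≢f (trans (sym (==-refl y)) (subst (λ w → (y == w) ≡ false) xy e))) (sym (≡ᵇ-true⇒≡ (c y) (c x) ceq)))) axy))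

    deg-exceptional : ∀ x → U x ≡ true → deg U x ≡ 2k-1
    deg-exceptional x ux = suc-injective (trans (+-comm 1 (deg U x)) (trans (cong (deg U x +_) (sym (∑-point-1 x)))
      (trans (sym (∑-distrib-+ (λ y → ⟦ U y ∧ a x y ⟧) (λ y → ⟦ y == x ⟧))) (trans (sum-cong-≗ (deg+1≡class x ux)) (class-size x ux)))))

    doubleEdges-exceptional : doubleEdges U ≡ 2k-1 * size U
    doubleEdges-exceptional = trans (sum-cong-≗ (λ x → trans (sum-cong-≗ (λ y → ⟦∧⟧ (U x) (U y ∧ a x y))) (trans (∑-* ⟦ U x ⟧ (λ y → ⟦ U y ∧ a x y ⟧)) (pointwise x))))
             (trans (∑-* 2k-1 (λ x → ⟦ U x ⟧)) refl)
      where
      pointwise : ∀ x → ⟦ U x ⟧ * deg U x ≡ 2k-1 * ⟦ U x ⟧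
      pointwise x with U x in ux
      ... | true = trans (+-identityʳ (deg U x)) (trans (deg-exceptional x ux) (sym (*-identityʳ 2k-1)))
      ... | false = sym (*-zeroʳ 2k-1)

    weight-exceptional : weight U ≡ 2k-1 * size U + j
    weight-exceptional = cong₂ _+_ doubleEdges-exceptional v-degree

    cliqueRest : Fin n → List (Fin n)
    cliqueRest y = filterᵇ (λ z → U z ∧ ((c z ≡ᵇ c y) ∧ not (z == y))) (fins n)

    clique-path : ∀ y → U y ≡ true → Distinct (y ∷ cliqueRest y) × Chain (y ∷ cliqueRest y) × length (cliqueRest y) ≡ 2k-1 × All∈ U (y ∷ cliqueRest y)
    clique-path y uy = dist , chain-clique (y ∷ cliqueRest y) cl dist , len , al
      where
      p = λ z → U z ∧ ((c z ≡ᵇ c y) ∧ not (z == y))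
      y∉ : (y ∈ᵇ cliqueRest y) ≡ false
      y∉ rewrite ∈-filterᵇ-fins p y | ==-refl y | ≡ᵇ-refl (c y) | uy = refl
      dist : Distinct (y ∷ cliqueRest y)
      dist = y∉ ∷ Distinct-filterᵇ p (fins n) (Distinct-fins n)
      inR : ∀ z → (z ∈ᵇ cliqueRest y) ≡ true → U z ≡ true × c z ≡ c y
      inR z e with U z | c z ≡ᵇ c y in ce | trans (sym (∈-filterᵇ-fins p z)) e
      ... | true | true | _ = refl , ≡ᵇ-true⇒≡ (c z) (c y) ce
      inIn : ∀ z → (z ∈ᵇ (y ∷ cliqueRest y)) ≡ true → U z ≡ true × c z ≡ c y
      inIn z e with z == y in ez
      ... | true rewrite ==-true z y ez = uy , refl
      ... | false = inR z e
      al : All∈ U (y ∷ cliqueRest y)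
      al z e = proj₁ (inIn z e)
      cl : ∀ p q → (p ∈ᵇ (y ∷ cliqueRest y)) ≡ true → (q ∈ᵇ (y ∷ cliqueRest y)) ≡ true → p ≢ q → a p q ≡ true
      cl p q pi qi ne = same⇒adjacent p q (proj₁ (inIn p pi)) (proj₁ (inIn q qi)) ne (trans (proj₂ (inIn p pi)) (sym (proj₂ (inIn q qi))))
      ptw : ∀ z → ⟦ U z ∧ (c z ≡ᵇ c y) ⟧ ≡ ⟦ p z ⟧ + ⟦ z == y ⟧
      ptw z with z == y in ez
      ... | true rewrite ==-true z y ez | uy | ≡ᵇ-refl (c y) = refl
      ... | false with U z
      ...   | false = refl
      ...   | true with c z ≡ᵇ c y
      ...     | true = refl
      ...     | false = refl
      len : length (cliqueRest y) ≡ 2k-1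
      len = suc-injective (trans (+-comm 1 _) (trans (cong₂ _+_ (length-filterᵇ-fins p) (sym (∑-point-1 y)))
            (trans (sym (∑-distrib-+ (λ z → ⟦ p z ⟧) (λ z → ⟦ z == y ⟧))) (trans (sym (sum-cong-≗ ptw)) (class-size y uy)))))

  All∈-≢v : ∀ (S : VSet) L → S v ≡ false → All∈ S L → ∀ z → (z ∈ᵇ L) ≡ true → z ≢ v
  All∈-≢v S L sv al z e refl = t≢f (trans (sym (al v e)) sv)

  no-path-through-v : ∀ (S : VSet) x u rest → S v ≡ false → x ≢ v → (x ∈ᵇ (u ∷ rest)) ≡ false → Distinct (u ∷ rest) → Chain (u ∷ rest)
          → All∈ S (u ∷ rest) → a x v ≡ true → a u v ≡ true → 2k-1 ≤ length (u ∷ rest) → ⊥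
  no-path-through-v S x u rest sv xv x∉ d c al axv auv len =
    no-long-path-from-edge x v (u ∷ rest) (xd ∷ (All∈-∉ S (u ∷ rest) v al sv ∷ d)) (axv , trans (asym v u) auv , c) xv
      (λ z e → All∈-≢v S (u ∷ rest) sv al z e) len
    where
    xd : (x ∈ᵇ (v ∷ u ∷ rest)) ≡ false
    xd rewrite ==-false xv | x∉ = refl

  no-path-through-edge : ∀ (S : VSet) x y rest → S v ≡ false → x ≢ v → (x ∈ᵇ (y ∷ rest)) ≡ false → Distinct (y ∷ rest) → Chain (y ∷ rest)
          → All∈ S (y ∷ rest) → a x y ≡ true → 2k-1 ≤ length rest → ⊥
  no-path-through-edge S x y rest sv xv x∉ d c al axy len =
    no-long-path-from-edge x y rest (x∉ ∷ d) (axy , c) xv (λ z e → All∈-≢v S (y ∷ rest) sv al z (∈-there z y rest e)) len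

  -- An edge into a K_{2k} component continues along the clique to a path on 2k + 1 vertices.
  exceptional-no-edge-out : ∀ {j S} → Exceptional j S → S v ≡ false → ∀ x y → x ≢ v → S x ≡ false → S y ≡ true → a x y ≡ true → ⊥
  exceptional-no-edge-out {S = S} ex sv x y xv sx sy axy =
    let (d , c , len , al) = ExceptionalProperties.clique-path ex y sy
    in no-path-through-edge S x y (ExceptionalProperties.cliqueRest ex y) sv xv (All∈-∉ S (y ∷ ExceptionalProperties.cliqueRest ex y) x al sx) d c al axy (≤-reflexive (sym len))

  exceptional-no-v-neighbour-out : ∀ {S} → Exceptional 1 S → S v ≡ false → ∀ x → x ≢ v → S x ≡ false → a x v ≡ true → ⊥
  exceptional-no-v-neighbour-out {S} ex sv x xv sx axv =
    let (u , su) = ∑⟦⟧>0⇒∃ (λ z → S z ∧ a z v) (≤-reflexive (sym (Exceptional.v-degree ex)))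
        (d , c , len , al) = ExceptionalProperties.clique-path ex u (∧-elimˡ su)
    in no-path-through-v S x u (ExceptionalProperties.cliqueRest ex u) sv xv (All∈-∉ S (u ∷ ExceptionalProperties.cliqueRest ex u) x al sx) d c al axv (∧-elimʳ su) (≤-trans (≤-reflexive (sym len)) (n≤1+n _))

  doubleEdges-∑deg : ∀ W → doubleEdges W ≡ ∑ (λ x → ⟦ W x ⟧ * deg W x)
  doubleEdges-∑deg W = sum-cong-≗ (λ x → trans (sum-cong-≗ (λ y → ⟦∧⟧ (W x) (W y ∧ a x y))) (∑-* ⟦ W x ⟧ (λ y → ⟦ W y ∧ a x y ⟧)))

  deg<size : ∀ W x → W x ≡ true → suc (deg W x) ≤ size W
  deg<size W x wx = ≤-trans (≤-reflexive (trans (+-comm 1 (deg W x)) (cong (deg W x +_) (sym (∑-point-1 x)))))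
    (≤-trans (≤-reflexive (sym (∑-distrib-+ (λ y → ⟦ W y ∧ a x y ⟧) (λ y → ⟦ y == x ⟧)))) (∑-mono pointwise))
    where
    pointwise : ∀ y → ⟦ W y ∧ a x y ⟧ + ⟦ y == x ⟧ ≤ ⟦ W y ⟧
    pointwise y with y == x in e
    ... | true rewrite ==-true y x e | airr x | wx = ≤-refl
    ... | false with W y
    ...   | true = ≤-trans (≤-reflexive (+-identityʳ _)) (⟦⟧≤1 (a x y))
    ...   | false = z≤n

  doubleEdges≤ : ∀ W → doubleEdges W ≤ size W * (size W ∸ 1)
  doubleEdges≤ W = ≤-trans (≤-reflexive (doubleEdges-∑deg W)) (≤-trans (∑-mono pointwise) (≤-reflexive (∑-*ʳ (size W ∸ 1) (λ x → ⟦ W x ⟧))))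
    where
    pointwise : ∀ x → ⟦ W x ⟧ * deg W x ≤ ⟦ W x ⟧ * (size W ∸ 1)
    pointwise x with W x in wx
    ... | true = +-mono-≤ (<⇒≤pred (deg<size W x wx)) z≤n
    ... | false = z≤n

  deg+2≤size : ∀ W p q → W p ≡ true → W q ≡ true → p ≢ q → a p q ≡ false → suc (suc (deg W p)) ≤ size W
  deg+2≤size W p q wp wq ne apq =
    ≤-trans (≤-reflexive (trans (+-comm 2 (deg W p)) (cong (deg W p +_) (sym (cong₂ _+_ (∑-point-1 p) (∑-point-1 q))))))
    (≤-trans (≤-reflexive (cong (deg W p +_) (sym (∑-distrib-+ (λ y → ⟦ y == p ⟧) (λ y → ⟦ y == q ⟧)))))
    (≤-trans (≤-reflexive (sym (∑-distrib-+ (λ y → ⟦ W y ∧ a p y ⟧) (λ y → ⟦ y == p ⟧ + ⟦ y == q ⟧)))) (∑-mono pointwise)))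
    where
    pointwise : ∀ y → ⟦ W y ∧ a p y ⟧ + (⟦ y == p ⟧ + ⟦ y == q ⟧) ≤ ⟦ W y ⟧
    pointwise y with y == p in e1 | y == q in e2
    ... | true | true = ⊥-elim (ne (trans (sym (==-true y p e1)) (==-true y q e2)))
    ... | true | false rewrite ==-true y p e1 | airr p | wp = ≤-refl
    ... | false | true rewrite ==-true y q e2 | apq | wq = ≤-refl
    ... | false | false with W y
    ...   | true = ≤-trans (≤-reflexive (+-identityʳ _)) (⟦⟧≤1 (a p y))
    ...   | false = z≤n

  doubleEdges-nonclique : ∀ W p q → W p ≡ true → W q ≡ true → p ≢ q → a p q ≡ false → suc (doubleEdges W) ≤ size W * (size W ∸ 1)
  doubleEdges-nonclique W p q wp wq ne apq =
    ≤-trans (s≤s (≤-reflexive (doubleEdges-∑deg W))) (≤-trans (∑-mono-< p pointwise strict) (≤-reflexive (∑-*ʳ (size W ∸ 1) (λ x → ⟦ W x ⟧))))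
    where
    pointwise : ∀ x → ⟦ W x ⟧ * deg W x ≤ ⟦ W x ⟧ * (size W ∸ 1)
    pointwise x with W x in wx
    ... | true = +-mono-≤ (<⇒≤pred (deg<size W x wx)) z≤n
    ... | false = z≤n
    strict : ⟦ W p ⟧ * deg W p < ⟦ W p ⟧ * (size W ∸ 1)
    strict rewrite wp = +-mono-≤ (<⇒≤pred (deg+2≤size W p q wp wq ne apq)) z≤n

  exceptional-extend : ∀ {j j'} U W → W ⊆ U → Closed U W →
     (∀ p q → W p ≡ true → W q ≡ true → p ≢ q → a p q ≡ true) → size W ≡ 2 * k →
     Exceptional j (U ∖ W) → dᵥ U ≡ j' → Exceptional j' U
  exceptional-extend U W sub cl clique sw ex dvU = record { c = c' ; adjacent⇒same = adjacent⇒same′ ; same⇒adjacent = same⇒adjacent′ ; class-size = class-size′ ; v-degree = dvU }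
    where
    open Exceptional ex renaming (c to c₀; adjacent⇒same to adjacent⇒same₀; same⇒adjacent to same⇒adjacent₀; class-size to class-size₀)
    U' = (U ∖ W)
    c' : Fin n → ℕ
    c' x = if W x then 0 else suc (c₀ x)
    inU' : ∀ x → U x ≡ true → W x ≡ false → U' x ≡ true
    inU' x ux wx rewrite ux | wx = refl
    adjacent⇒same′ : ∀ x y → U x ≡ true → U y ≡ true → a x y ≡ true → c' x ≡ c' y
    adjacent⇒same′ x y ux uy axy with W x in wx | W y in wy
    ... | true | true = refl
    ... | true | false = ⊥-elim (t≢f (trans (sym axy) (cl x y wx (inU' y uy wy))))
    ... | false | true = ⊥-elim (t≢f (trans (sym axy) (trans (asym x y) (cl y x wy (inU' x ux wx)))))
    ... | false | false = cong suc (adjacent⇒same₀ x y (inU' x ux wx) (inU' y uy wy) axy)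
    same⇒adjacent′ : ∀ x y → U x ≡ true → U y ≡ true → x ≢ y → c' x ≡ c' y → a x y ≡ true
    same⇒adjacent′ x y ux uy ne ce with W x in wx | W y in wy
    ... | true | true = clique x y wx wy ne
    ... | true | false = ⊥-elim (0≢1+n ce)
    ... | false | true = ⊥-elim (0≢1+n (sym ce))
    ... | false | false = same⇒adjacent₀ x y (inU' x ux wx) (inU' y uy wy) ne (suc-injective ce)
    class-size′ : ∀ x → U x ≡ true → ∑ (λ y → ⟦ U y ∧ (c' y ≡ᵇ c' x) ⟧) ≡ 2 * k
    class-size′ x ux with W x in wx
    ... | true = trans (sum-cong-≗ pointwise) sw
      where
      pointwise : ∀ y → ⟦ U y ∧ (c' y ≡ᵇ 0) ⟧ ≡ ⟦ W y ⟧
      pointwise y with W y in wy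
      ... | true rewrite sub y wy = refl
      ... | false = cong ⟦_⟧ (∧-zeroʳ (U y))
    ... | false = trans (sum-cong-≗ pointwise) (class-size₀ x (inU' x ux wx))
      where
      pointwise : ∀ y → ⟦ U y ∧ (c' y ≡ᵇ suc (c₀ x)) ⟧ ≡ ⟦ U' y ∧ (c₀ y ≡ᵇ c₀ x) ⟧
      pointwise y with W y
      ... | true = trans (cong ⟦_⟧ (∧-zeroʳ (U y))) (cong ⟦_⟧ (sym (trans (cong (_∧ (c₀ y ≡ᵇ c₀ x)) (∧-zeroʳ (U y))) refl)))
      ... | false = cong (λ b → ⟦ b ∧ (c₀ y ≡ᵇ c₀ x) ⟧) (sym (∧-identityʳ (U y)))

  PathIn : VSet → List (Fin n) → Set
  PathIn S L = Distinct L × Chain L × All∈ S L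

  PathOfLength : VSet → ℕ → Set
  PathOfLength S j = Σ[ L ∈ List (Fin n) ] PathIn S L × length L ≡ j

  no-long-path : ∀ S → S v ≡ false → ¬ PathOfLength S (suc (2 * k))
  no-long-path S sv ((x ∷ xs) , (d , c , al) , e) =
    no-forbidden-path x xs d c (suc-injective e) (All∈-≢v S (x ∷ xs) sv al x (∈-head x xs)) (All∈-≢v S (x ∷ xs) sv al (last' x xs) (last∈ x xs))

  longest-path : ∀ {A : Set} (S : VSet) → Stable A → S v ≡ false → (x₀ : Fin n) → S x₀ ≡ true →
    (∀ L → PathIn S L → 1 ≤ length L → length L ≤ 2 * k → ¬ PathOfLength S (suc (length L)) → A) → A
  longest-path {A} S st sv x₀ sx f = go (2 * k) (x₀ ∷ []) ((refl ∷ []) , tt , al0) (s≤s z≤n) refl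
    where
    al0 : All∈ S (x₀ ∷ [])
    al0 z e rewrite ==-true z x₀ (trans (sym (∨-identityʳ (z == x₀))) e) = sx
    go : ∀ d L → PathIn S L → 1 ≤ length L → length L + d ≡ suc (2 * k) → A
    go zero L p h e = ⊥-elim (no-long-path S sv (L , p , trans (sym (+-identityʳ _)) e))
    go (suc d) L p h e = by-cases (PathOfLength S (suc (length L))) st λ where
      (inj₁ (L' , p' , e')) → go d L' p' (≤-trans h (≤-trans (n≤1+n _) (≤-reflexive (sym e'))))
                                (trans (cong (_+ d) e') (trans (sym (+-suc (length L) d)) e))
      (inj₂ maximal) → f L p h (≤-trans (m≤m+n (length L) d) (≤-reflexive (suc-injective (trans (sym (+-suc (length L) d)) e)))) maximal

  -- endHits f g L counts the consecutive pairs x, y of L with f y plus those with g x, so it exceeds the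
  -- number of such pairs only if some pair has both.
  endHits : (Fin n → Bool) → (Fin n → Bool) → List (Fin n) → ℕ
  endHits fb gb [] = 0
  endHits fb gb (x ∷ []) = 0
  endHits fb gb (x ∷ y ∷ zs) = (⟦ fb y ⟧ + ⟦ gb x ⟧) + endHits fb gb (y ∷ zs)

  private
    r1 : ∀ f g → 0 + f + g ≡ (f + 0) + (g + 0)
    r1 = solve-∀
    r2 : ∀ fy gx s fx gl → ((fy + gx) + s) + fx + gl ≡ (fx + gx) + ((s + fy) + gl)
    r2 = solve-∀
    r3 : ∀ fx gx sf sg → (fx + gx) + (sf + sg) ≡ (fx + sf) + (gx + sg)
    r3 = solve-∀

  endHits-sum : ∀ fb gb x xs → endHits fb gb (x ∷ xs) + ⟦ fb x ⟧ + ⟦ gb (last' x xs) ⟧ ≡ sumL (λ z → ⟦ fb z ⟧) (x ∷ xs) + sumL (λ z → ⟦ gb z ⟧) (x ∷ xs)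
  endHits-sum fb gb x [] = r1 ⟦ fb x ⟧ ⟦ gb x ⟧
  endHits-sum fb gb x (y ∷ zs) = trans (r2 ⟦ fb y ⟧ ⟦ gb x ⟧ (endHits fb gb (y ∷ zs)) ⟦ fb x ⟧ ⟦ gb (last' y zs) ⟧)
      (trans (cong (⟦ fb x ⟧ + ⟦ gb x ⟧ +_) (endHits-sum fb gb y zs)) (r3 ⟦ fb x ⟧ ⟦ gb x ⟧ _ _))

  crossing-split : ∀ fb gb x xs → length xs < endHits fb gb (x ∷ xs) →
    Σ[ as ∈ List (Fin n) ] Σ[ y ∈ Fin n ] Σ[ bs ∈ List (Fin n) ]
      ((x ∷ xs) ≡ (x ∷ as) ++ (y ∷ bs)) × fb y ≡ true × gb (last' x as) ≡ true
  crossing-split fb gb x [] ()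
  crossing-split fb gb x (y ∷ ys) h with fb y in e1 | gb x in e2
  ... | true | true = [] , y , ys , refl , e1 , e2
  ... | true | false = rec (≤-pred h)
    where
    rec : length ys < endHits fb gb (y ∷ ys) → _
    rec h' = let (as , y' , bs , eq , f , g) = crossing-split fb gb y ys h' in y ∷ as , y' , bs , cong (x ∷_) eq , f , g
  ... | false | true = rec (≤-pred h)
    where
    rec : length ys < endHits fb gb (y ∷ ys) → _
    rec h' = let (as , y' , bs , eq , f , g) = crossing-split fb gb y ys h' in y ∷ as , y' , bs , cong (x ∷_) eq , f , g
  ... | false | false = rec (≤-trans (n≤1+n _) h)
    where
    rec : length ys < endHits fb gb (y ∷ ys) → _
    rec h' = let (as , y' , bs , eq , f , g) = crossing-split fb gb y ys h' in y ∷ as , y' , bs , cong (x ∷_) eq , f , g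

  Cycle : VSet → List (Fin n) → Set
  Cycle S [] = ⊥
  Cycle S (c ∷ cs) = PathIn S (c ∷ cs) × a (last' c cs) c ≡ true

  ∈-single : ∀ (z y : Fin n) → (z ∈ᵇ (y ∷ [])) ≡ true → z ≡ y
  ∈-single z y e = ==-true z y (trans (sym (∨-identityʳ (z == y))) e)

  All∈-cons : ∀ S y L → S y ≡ true → All∈ S L → All∈ S (y ∷ L)
  All∈-cons S y L sy al z e with z == y in ez
  ... | true rewrite ==-true z y ez = sy
  ... | false = al z e

  All∈-++ : ∀ S L M → All∈ S L → All∈ S M → All∈ S (L ++ M)
  All∈-++ S L M al am z e with ∨-true (trans (sym (∈-++ z L M)) e)
  ... | inj₁ e1 = al z e1
  ... | inj₂ e2 = am z e2

  head-neighbours-on-path : ∀ S x xs → PathIn S (x ∷ xs) → ¬ PathOfLength S (suc (length (x ∷ xs))) →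
    ∀ y → S y ≡ true → a x y ≡ true → (y ∈ᵇ (x ∷ xs)) ≡ true
  head-neighbours-on-path S x xs (d , c , al) maximal y sy axy with y ∈ᵇ (x ∷ xs) in e
  ... | true = refl
  ... | false = ⊥-elim (maximal (y ∷ x ∷ xs , (e ∷ d , (trans (asym y x) axy , c) , All∈-cons S y (x ∷ xs) sy al) , refl))

  last-neighbours-on-path : ∀ S x xs → PathIn S (x ∷ xs) → ¬ PathOfLength S (suc (length (x ∷ xs))) →
    ∀ y → S y ≡ true → a (last' x xs) y ≡ true → (y ∈ᵇ (x ∷ xs)) ≡ true
  last-neighbours-on-path S x xs (d , c , al) maximal y sy ay with y ∈ᵇ L in e
    where L = x ∷ xs
  ... | true = refl
  ... | false = ⊥-elim (maximal (L ++ (y ∷ []) , (Distinct-++ d (refl ∷ []) disjoint , chain-++ L (y ∷ []) c tt ay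
                                                  , All∈-++ S L (y ∷ []) al (All∈-cons S y [] sy (λ z ())))
                                 , trans (length-++ L) (+-comm (length L) 1)))
    where
    L = x ∷ xs
    disjoint : ∀ z → (z ∈ᵇ L) ≡ true → (z ∈ᵇ (y ∷ [])) ≡ false
    disjoint z ez with z ∈ᵇ (y ∷ []) in e′
    ... | true = ⊥-elim (t≢f (trans (sym (subst (λ w → (w ∈ᵇ L) ≡ true) (∈-single z y e′) ez)) e))
    ... | false = refl

  deg≤neighbours-on : ∀ S L x → Distinct L → (∀ y → S y ≡ true → a x y ≡ true → (y ∈ᵇ L) ≡ true) →
    deg S x ≤ sumL (λ z → ⟦ a x z ⟧) L
  deg≤neighbours-on S L x d onL = ≤-trans (∑-mono counted) (≤-reflexive (∑-∈ᵇ (λ z → ⟦ a x z ⟧) L d))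
    where
    counted : ∀ y → ⟦ S y ∧ a x y ⟧ ≤ ⟦ y ∈ᵇ L ⟧ * ⟦ a x y ⟧
    counted y with S y in sy | a x y in ay
    ... | true | true rewrite onL y sy ay = ≤-refl
    ... | true | false = z≤n
    ... | false | _ = z≤n

  cycle-from-crossing : ∀ S p as y bs → PathIn S ((p ∷ as) ++ (y ∷ bs)) →
    a p y ≡ true → a (last' y bs) (last' p as) ≡ true →
    Cycle S ((p ∷ as) ++ reverse (y ∷ bs)) × length ((p ∷ as) ++ reverse (y ∷ bs)) ≡ length ((p ∷ as) ++ (y ∷ bs))
  cycle-from-crossing S p as y bs (d , c , al) apy across = ((dC , cC , alC) , closing) , lenC
    where
    A B C : List (Fin n)
    A = p ∷ as
    B = y ∷ bs
    C = A ++ reverse B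
    closing : a (last' p (as ++ reverse B)) p ≡ true
    closing rewrite just-injective (lastM-++' A (reverse B) y (lastM-reverse B)) = trans (asym y p) apy
    junction : Joins (lastM A) (head (reverse B))
    junction = subst (Joins (lastM A)) (sym (head-reverse B)) (trans (asym (last' p as) (last' y bs)) across)
    cC : Chain C
    cC = chain-++ A (reverse B) (chain-++⁻ˡ A B c) (chain-reverse asym B (chain-++⁻ʳ A B c)) junction
    dC : Distinct C
    dC = Distinct-++ (Distinct-++⁻ˡ A d) (Distinct-reverse B (Distinct-++⁻ʳ A d)) (λ z e → trans (∈-reverse z B) (Distinct-++⁻disj A d z e))
    alC : All∈ S C
    alC z e = al z (trans (sym (trans (∈-++ z A (reverse B)) (trans (cong ((z ∈ᵇ A) ∨_) (∈-reverse z B)) (sym (∈-++ z A B))))) e)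
    lenC : length C ≡ length (A ++ B)
    lenC = trans (length-++ A) (trans (cong (length A +_) (length-reverse B)) (sym (length-++ A)))

  -- Pósa's argument: the ends of a maximal path have all their neighbours on it, and at least k each,
  -- so some consecutive pair (x, y) of the path has y adjacent to the first and x adjacent to the last vertex.
  posa-cycle : ∀ S L → PathIn S L → 1 ≤ length L → length L ≤ 2 * k → ¬ PathOfLength S (suc (length L)) →
    (∀ x → S x ≡ true → k ≤ deg S x) → Σ[ C ∈ List (Fin n) ] Cycle S C × length C ≡ length L
  posa-cycle S (p ∷ L₁) path@(d , c , al) _ len≤2k maximal highDeg with crossing-split (a p) (a q) p L₁ crossing
    where
    q = last' p L₁
    crossing : length L₁ < endHits (a p) (a q) (p ∷ L₁)
    crossing = begin-strict
      length L₁                                                 <⟨ len≤2k ⟩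
      2 * k                                                     ≡⟨ cong (k +_) (+-identityʳ k) ⟩
      k + k                                                     ≤⟨ +-mono-≤ (highDeg p (al p (∈-head p L₁))) (highDeg q (al q (last∈ p L₁))) ⟩
      deg S p + deg S q                                         ≤⟨ +-mono-≤ (deg≤neighbours-on S _ p d (head-neighbours-on-path S p L₁ path maximal))
                                                                            (deg≤neighbours-on S _ q d (last-neighbours-on-path S p L₁ path maximal)) ⟩
      sumL (λ z → ⟦ a p z ⟧) (p ∷ L₁) + sumL (λ z → ⟦ a q z ⟧) (p ∷ L₁) ≡⟨ endHits-sum (a p) (a q) p L₁ ⟨
      endHits (a p) (a q) (p ∷ L₁) + ⟦ a p p ⟧ + ⟦ a q q ⟧          ≡⟨ cong₂ (λ s t → endHits (a p) (a q) (p ∷ L₁) + ⟦ s ⟧ + ⟦ t ⟧) (airr p) (airr q) ⟩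
      endHits (a p) (a q) (p ∷ L₁) + 0 + 0                      ≡⟨ trans (+-identityʳ _) (+-identityʳ _) ⟩
      endHits (a p) (a q) (p ∷ L₁)                              ∎
      where open ≤-Reasoning
  ... | as , y , bs , eqL , apy , aqx =
    let (cyc , lenC) = cycle-from-crossing S p as y bs (subst (PathIn S) eqL path) apy
                         (subst (λ z → a z (last' p as) ≡ true) (just-injective (trans (cong lastM eqL) (lastM-++ (p ∷ as) y bs))) aqx)
    in (p ∷ as) ++ reverse (y ∷ bs) , cyc , trans lenC (cong length (sym eqL))

  rotate-cycle : ∀ S c cs → Cycle S (c ∷ cs) → ∀ w → (w ∈ᵇ (c ∷ cs)) ≡ true →
      Σ[ Q ∈ List (Fin n) ] PathIn S (w ∷ Q) × length (w ∷ Q) ≡ length (c ∷ cs) × (∀ z → (z ∈ᵇ (w ∷ Q)) ≡ (z ∈ᵇ (c ∷ cs)))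
  rotate-cycle S c cs ((d , ch , al) , cl) w wi with ∈-split w (c ∷ cs) wi
  ... | A , B , eq = B ++ A , (dQ , chQ , alQ) , lenQ , memQ
    where
    WB = w ∷ B
    dCA : Distinct (A ++ WB)
    dCA = subst Distinct eq d
    chCA : Chain (A ++ WB)
    chCA = subst Chain eq ch
    disj' : ∀ z → (z ∈ᵇ WB) ≡ true → (z ∈ᵇ A) ≡ false
    disj' z e with z ∈ᵇ A in ea
    ... | true = ⊥-elim (t≢f (trans (sym e) (Distinct-++⁻disj A dCA z ea)))
    ... | false = refl
    dQ : Distinct (WB ++ A)
    dQ = Distinct-++ (Distinct-++⁻ʳ A dCA) (Distinct-++⁻ˡ A dCA) disj'
    junc : ∀ A' → (c ∷ cs) ≡ A' ++ WB → Joins (lastM WB) (head A')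
    junc [] e = tt
    junc (a0 ∷ as) e = subst₂ (λ p q → a p q ≡ true) lst hd cl
      where
      hd : c ≡ a0
      hd = cong (λ { [] → c ; (x ∷ _) → x }) e
      lst : last' c cs ≡ last' w B
      lst = just-injective (trans (cong lastM e) (lastM-++ (a0 ∷ as) w B))
    chQ : Chain (WB ++ A)
    chQ = chain-++ WB A (chain-++⁻ʳ A WB chCA) (chain-++⁻ˡ A WB chCA) (junc A eq)
    memQ : ∀ z → (z ∈ᵇ (WB ++ A)) ≡ (z ∈ᵇ (c ∷ cs))
    memQ z = trans (∈-++ z WB A) (trans (∨-comm (z ∈ᵇ WB) (z ∈ᵇ A)) (trans (sym (∈-++ z A WB)) (cong (z ∈ᵇ_) (sym eq))))
    alQ : All∈ S (WB ++ A)
    alQ z e = al z (trans (sym (memQ z)) e)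
    lenQ : length (WB ++ A) ≡ length (c ∷ cs)
    lenQ = trans (length-++ WB) (trans (+-comm (length WB) (length A)) (trans (sym (length-++ A)) (cong length (sym eq))))

  -- Rotating the cycle to start at w, an edge wy leaving it prepends y to a longer path.
  cycle-closed : ∀ S c cs → Cycle S (c ∷ cs) → ¬ PathOfLength S (suc (length (c ∷ cs))) →
     ∀ w y → (w ∈ᵇ (c ∷ cs)) ≡ true → S y ≡ true → (y ∈ᵇ (c ∷ cs)) ≡ false → a w y ≡ false
  cycle-closed S c cs cyc mx w y wi sy yn with a w y in awy
  ... | false = refl
  ... | true with rotate-cycle S c cs cyc w wi
  ...   | Q , (dq , cq , aq) , lq , mq =
          ⊥-elim (mx (y ∷ w ∷ Q , ((trans (mq y) yn) ∷ dq , (trans (asym y w) awy , cq) , All∈-cons S y (w ∷ Q) sy aq) , cong suc lq))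

  All∈-++ˡ : ∀ S L M → All∈ S (L ++ M) → All∈ S L
  All∈-++ˡ S L M al z e = al z (trans (∈-++ z L M) (cong (_∨ (z ∈ᵇ M)) e))

  All∈-++ʳ : ∀ S L M → All∈ S (L ++ M) → All∈ S M
  All∈-++ʳ S L M al z e = al z (trans (∈-++ z L M) (trans (cong ((z ∈ᵇ L) ∨_) e) (∨-comm (z ∈ᵇ L) true)))

  -- Split the cycle at its neighbours w₁, w₂ of v and join the two arcs through v.
  cycle-v-neighbours : ∀ S c cs → S v ≡ false → Cycle S (c ∷ cs) → length (c ∷ cs) ≡ 2 * k →
     ∀ w1 w2 → w1 ≢ w2 → (w1 ∈ᵇ (c ∷ cs)) ≡ true → (w2 ∈ᵇ (c ∷ cs)) ≡ true → a w1 v ≡ true → a w2 v ≡ true → ⊥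
  cycle-v-neighbours S c cs sv cyc len w1 w2 ne i1 i2 a1 a2 with rotate-cycle S c cs cyc w1 i1
  ... | Q , (dq , cq , aq) , lq , mq = go (∈-split w2 Q w2Q)
    where
    w2Q : (w2 ∈ᵇ Q) ≡ true
    w2Q = subst (λ b → (b ∨ (w2 ∈ᵇ Q)) ≡ true) (==-false (λ e → ne (sym e))) (trans (mq w2) i2)
    go : (Σ[ M ∈ List (Fin n) ] Σ[ N ∈ List (Fin n) ] Q ≡ M ++ (w2 ∷ N)) → ⊥
    go (M , N , eqQ) = no-forbidden-path′ Gd dG cG lenG hd lt
      where
      P1 P2 Gd : List (Fin n)
      P1 = w1 ∷ M
      P2 = w2 ∷ N
      Gd = reverse P1 ++ (v ∷ P2)
      dP : Distinct (P1 ++ P2)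
      dP = subst (λ q → Distinct (w1 ∷ q)) eqQ dq
      cP : Chain (P1 ++ P2)
      cP = subst (λ q → Chain (w1 ∷ q)) eqQ cq
      aP : All∈ S (P1 ++ P2)
      aP = subst (λ q → All∈ S (w1 ∷ q)) eqQ aq
      a1' = All∈-++ˡ S P1 P2 aP
      a2' = All∈-++ʳ S P1 P2 aP
      disj : ∀ z → (z ∈ᵇ reverse P1) ≡ true → (z ∈ᵇ (v ∷ P2)) ≡ false
      disj z e = let e' = trans (sym (∈-reverse z P1)) e in
        subst₂ (λ b b' → (b ∨ b') ≡ false) (sym (==-false (All∈-≢v S P1 sv a1' z e'))) (sym (Distinct-++⁻disj P1 dP z e')) refl
      dG : Distinct Gd
      dG = Distinct-++ (Distinct-reverse P1 (Distinct-++⁻ˡ P1 dP)) (All∈-∉ S P2 v a2' sv ∷ Distinct-++⁻ʳ P1 dP) disj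
      cG : Chain Gd
      cG = chain-++ (reverse P1) (v ∷ P2) (chain-reverse asym P1 (chain-++⁻ˡ P1 P2 cP)) (trans (asym v w2) a2 , chain-++⁻ʳ P1 P2 cP)
             (subst (λ m → Joins m (just v)) (sym (lastM-reverse P1)) a1)
      lenG : length Gd ≡ suc (2 * k)
      lenG = trans (length-++ (reverse P1)) (trans (cong (_+ length (v ∷ P2)) (length-reverse P1))
             (trans (+-suc (length P1) (length P2)) (cong suc (trans (sym (length-++ P1)) (trans (cong (λ q → length (w1 ∷ q)) (sym eqQ)) (trans lq len))))))
      hd : ∀ z → head Gd ≡ just z → z ≢ v
      hd z e = All∈-≢v S P1 sv a1' z (subst (λ t → (t ∈ᵇ P1) ≡ true) (just-injective (trans (sym (head-++ (reverse P1) (v ∷ P2) (last' w1 M) (head-reverse P1))) e)) (last∈ w1 M))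
      lt : ∀ z → lastM Gd ≡ just z → z ≢ v
      lt z e = All∈-≢v S P2 sv a2' z (subst (λ t → (t ∈ᵇ P2) ≡ true) (just-injective (trans (sym (lastM-++' (reverse P1) (v ∷ P2) (last' w2 N) refl)) e)) (last∈ w2 N))

  Claim : VSet → Set
  Claim U = (¬ Exceptional 1 U → weight U ≤ 2k-1 * size U) × (dᵥ U ≡ 0 → ¬ Exceptional 0 U → suc (weight U) ≤ 2k-1 * size U)

  claim-stable : ∀ U → Stable (Claim U)
  claim-stable U = stable-× (stable-→ (decidable-stable (_ ≤? _))) (stable-→ (stable-→ (decidable-stable (_ ≤? _))))

  ∑⟦⟧-none : ∀ (b : Fin n → Bool) → (∀ y → b y ≡ true → ⊥) → ∑ (λ y → ⟦ b y ⟧) ≡ 0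
  ∑⟦⟧-none b h = ∑-≡0 (λ y → ⟦ b y ⟧) pointwise
    where
    pointwise : ∀ y → ⟦ b y ⟧ ≡ 0
    pointwise y with b y in e
    ... | true = ⊥-elim (h y e)
    ... | false = refl

  1≤2k-1 : 1 ≤ 2k-1
  1≤2k-1 = ≤-trans (s≤s z≤n) (≤-reflexive (sym (+-suc k' (k' + 0))))

  2d+b≤2k-1 : ∀ d b → d < k → b ≤ 1 → (d + d) + b ≤ 2k-1
  2d+b≤2k-1 d b (s≤s d≤k') b≤1 = ≤-trans (+-mono-≤ (+-mono-≤ d≤k' d≤k') b≤1)
     (≤-reflexive (trans (+-comm (k' + k') 1) (trans (cong suc (cong (k' +_) (sym (+-identityʳ k')))) (sym (+-suc k' (k' + 0))))))

  split-bound : ∀ {TU SU} TU' S' X j → TU ≡ TU' + X → SU ≡ S' + j → TU' + X ≤ 2k-1 * S' + 2k-1 * j → TU ≤ 2k-1 * SU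
  split-bound TU' S' X j refl refl h = ≤-trans h (≤-reflexive (sym (*-distribˡ-+ 2k-1 _ j)))

  split-bound-strict : ∀ {TU SU} TU' S' X j → TU ≡ TU' + X → SU ≡ S' + j → suc (TU' + X) ≤ 2k-1 * S' + 2k-1 * j → suc TU ≤ 2k-1 * SU
  split-bound-strict TU' S' X j refl refl h = ≤-trans h (≤-reflexive (sym (*-distribˡ-+ 2k-1 _ j)))

  v∉∖ : ∀ (U W : VSet) → U v ≡ false → (U ∖ W) v ≡ false
  v∉∖ U W sv rewrite sv = refl

  ∈⇒≢v : ∀ (U : VSet) x → U v ≡ false → U x ≡ true → x ≢ v
  ∈⇒≢v U x sv ux refl = t≢f (trans (sym ux) sv)

  ∈⇒∉∖ : ∀ (U W : VSet) x → W x ≡ true → (U ∖ W) x ≡ false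
  ∈⇒∉∖ U W x wx rewrite wx = ∧-zeroʳ (U x)

  claim-empty : ∀ U → size U ≡ 0 → Claim U
  claim-empty U s0 = (λ _ → ≤-trans (≤-reflexive T0) z≤n) , (λ dv0 nE → ⊥-elim (nE (ex dv0)))
    where
    uf : ∀ x → U x ≡ false
    uf = ∑⟦⟧≡0⇒false U s0
    T0 : weight U ≡ 0
    T0 = cong₂ _+_ (∑∑-≡0 _ (λ x y → cong (λ b → ⟦ b ∧ (U y ∧ a x y) ⟧) (uf x))) (∑-≡0 _ (λ x → cong (λ b → ⟦ b ∧ a x v ⟧) (uf x)))
    ex : dᵥ U ≡ 0 → Exceptional 0 U
    ex dv0 = record { c = λ _ → 0 ; adjacent⇒same = λ x y ux → ⊥-elim (t≢f (trans (sym ux) (uf x)))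
                ; same⇒adjacent = λ x y ux → ⊥-elim (t≢f (trans (sym ux) (uf x)))
                ; class-size = λ x ux → ⊥-elim (t≢f (trans (sym ux) (uf x))) ; v-degree = dv0 }

  2k-1≡2k-1*1 : 2k-1 ≡ 2k-1 * 1
  2k-1≡2k-1*1 = sym (*-identityʳ 2k-1)

  suc≤+2k-1 : ∀ A → suc A ≤ A + 2k-1 * 1
  suc≤+2k-1 A = ≤-trans (≤-reflexive (+-comm 1 A)) (+-monoʳ-≤ A (≤-trans 1≤2k-1 (≤-reflexive 2k-1≡2k-1*1)))

  Hypothesis : VSet → Set
  Hypothesis U = ∀ U' → size U' < size U → U' v ≡ false → Claim U'

  module LowDegreeCase (U : VSet) (v∉U : U v ≡ false) (IH : Hypothesis U) (x : Fin n) (x∈U : U x ≡ true)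
                       (low : deg U x < k) where
    open ≤-Reasoning

    U' : VSet
    U' = U ∖ ⁅ x ⁆

    d : ℕ
    d = deg U x

    weight-U : weight U ≡ weight U' + ((d + d) + ⟦ a x v ⟧)
    weight-U = weight-∖⁅⁆ U x x∈U

    size-U : size U ≡ size U' + 1
    size-U = trans (size-∖ U ⁅ x ⁆ (⁅⁆⊆ U x x∈U)) (cong (size U' +_) (size-⁅⁆ x))

    dᵥ-U : dᵥ U ≡ dᵥ U' + ⟦ a x v ⟧
    dᵥ-U = trans (dᵥ-∖ U ⁅ x ⁆ (⁅⁆⊆ U x x∈U)) (cong (dᵥ U' +_) (dᵥ-⁅⁆ x))

    v∉U' : U' v ≡ false
    v∉U' = v∉∖ U ⁅ x ⁆ v∉U

    IH' : Claim U'
    IH' = IH U' (≤-reflexive (trans (+-comm 1 (size U')) (sym size-U))) v∉U'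

    x∉U' : U' x ≡ false
    x∉U' = ∈⇒∉∖ U ⁅ x ⁆ x (==-refl x)

    isolated : ∀ {j} → Exceptional j U' → d ≡ 0
    isolated ex = trans (deg-∖⁅⁆ U x) (∑⟦⟧-none (λ y → U' y ∧ a x y) λ y e →
      exceptional-no-edge-out ex v∉U' x y (∈⇒≢v U x v∉U x∈U) x∉U' (∧-elimˡ e) (∧-elimʳ e))

    x≁v : Exceptional 1 U' → a x v ≡ false
    x≁v ex with a x v in e
    ... | true = ⊥-elim (exceptional-no-v-neighbour-out ex v∉U' x (∈⇒≢v U x v∉U x∈U) x∉U' e)
    ... | false = refl

    removed≤ : (d + d) + ⟦ a x v ⟧ ≤ 2k-1 * 1
    removed≤ = ≤-trans (2d+b≤2k-1 d ⟦ a x v ⟧ low (⟦⟧≤1 _)) (≤-reflexive 2k-1≡2k-1*1)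

    close : weight U' + ((d + d) + ⟦ a x v ⟧) ≤ 2k-1 * size U' + 2k-1 * 1 → weight U ≤ 2k-1 * size U
    close = split-bound (weight U') (size U') ((d + d) + ⟦ a x v ⟧) 1 weight-U size-U

    close-strict : suc (weight U' + ((d + d) + ⟦ a x v ⟧)) ≤ 2k-1 * size U' + 2k-1 * 1 → suc (weight U) ≤ 2k-1 * size U
    close-strict = split-bound-strict (weight U') (size U') ((d + d) + ⟦ a x v ⟧) 1 weight-U size-U

    bound : ¬ Exceptional 1 U → weight U ≤ 2k-1 * size U
    bound _ = by-cases (Exceptional 1 U') (decidable-stable (_ ≤? _)) λ where
      (inj₁ ex) → close (begin
        weight U' + ((d + d) + ⟦ a x v ⟧)  ≡⟨ cong₂ _+_ (ExceptionalProperties.weight-exceptional ex)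
                                                         (cong₂ (λ p q → (p + p) + ⟦ q ⟧) (isolated ex) (x≁v ex)) ⟩
        (2k-1 * size U' + 1) + 0           ≡⟨ +-identityʳ _ ⟩
        2k-1 * size U' + 1                 ≤⟨ +-monoʳ-≤ (2k-1 * size U') (≤-trans 1≤2k-1 (≤-reflexive 2k-1≡2k-1*1)) ⟩
        2k-1 * size U' + 2k-1 * 1          ∎)
      (inj₂ ¬ex) → close (+-mono-≤ (proj₁ IH' ¬ex) removed≤)

    x≁v′ : dᵥ U ≡ 0 → ⟦ a x v ⟧ ≡ 0
    x≁v′ dᵥ-U≡0 = m+n≡0⇒n≡0 (dᵥ U') (trans (sym dᵥ-U) dᵥ-U≡0)

    bound-strict : dᵥ U ≡ 0 → ¬ Exceptional 0 U → suc (weight U) ≤ 2k-1 * size U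
    bound-strict dᵥ-U≡0 _ = by-cases (Exceptional 0 U') (decidable-stable (_ ≤? _)) λ where
      (inj₁ ex) → close-strict (begin
        suc (weight U' + ((d + d) + ⟦ a x v ⟧))  ≡⟨ cong suc (cong₂ _+_ (ExceptionalProperties.weight-exceptional ex)
                                                         (cong₂ (λ p q → (p + p) + q) (isolated ex) (x≁v′ dᵥ-U≡0))) ⟩
        suc ((2k-1 * size U' + 0) + 0)           ≡⟨ cong suc (trans (+-identityʳ _) (+-identityʳ _)) ⟩
        suc (2k-1 * size U')                     ≤⟨ suc≤+2k-1 (2k-1 * size U') ⟩
        2k-1 * size U' + 2k-1 * 1                ∎)
      (inj₂ ¬ex) → close-strict (+-mono-≤ (proj₂ IH' (m+n≡0⇒m≡0 (dᵥ U') (trans (sym dᵥ-U) dᵥ-U≡0)) ¬ex) removed≤)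

    claim : Claim U
    claim = bound , bound-strict

  notT : ∀ b → not b ≡ true → b ≡ false
  notT false e = refl

  small-cycle-bound : ∀ j → 1 ≤ j → j ≤ 2k-1 → j * (j ∸ 1) + j ≤ 2k-1 * j
  small-cycle-bound (suc j) _ j≤ = begin
    suc j * j + suc j  ≡⟨ +-comm (suc j * j) (suc j) ⟩
    suc j + suc j * j  ≡⟨ *-suc (suc j) j ⟨
    suc j * suc j      ≤⟨ *-monoˡ-≤ (suc j) j≤ ⟩
    2k-1 * suc j       ∎
    where open ≤-Reasoning

  small-cycle-bound-strict : ∀ j → 1 ≤ j → j ≤ 2k-1 → suc (j * (j ∸ 1)) ≤ 2k-1 * j
  small-cycle-bound-strict j 1≤j j≤ =
    ≤-trans (≤-trans (≤-reflexive (+-comm 1 _)) (+-monoʳ-≤ (j * (j ∸ 1)) 1≤j)) (small-cycle-bound j 1≤j j≤)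

  full-cycle-pairs : ∀ j → j ≡ 2 * k → j * (j ∸ 1) ≡ 2k-1 * j
  full-cycle-pairs j refl = *-comm (2 * k) 2k-1

  module CycleCase (U : VSet) (v∉U : U v ≡ false) (IH : Hypothesis U) (c : Fin n) (cs : List (Fin n)) (j : ℕ)
                   (cyc : Cycle U (c ∷ cs)) (lenC : length (c ∷ cs) ≡ j) (1≤j : 1 ≤ j) (j≤2k : j ≤ 2 * k)
                   (maximal : ¬ PathOfLength U (suc j)) where
    C : List (Fin n)
    C = c ∷ cs

    W : VSet
    W z = z ∈ᵇ C

    U' : VSet
    U' = U ∖ W

    W⊆U : ∀ x → W x ≡ true → U x ≡ true
    W⊆U = proj₂ (proj₂ (proj₁ cyc))

    U'∩W : ∀ y → U' y ≡ true → W y ≡ false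
    U'∩W y e = notT (W y) (∧-elimʳ e)

    closed : Closed U W
    closed x y wx u'y = cycle-closed U c cs cyc (subst (λ m → ¬ PathOfLength U (suc m)) (sym lenC) maximal)
                                     x y wx (∧-elimˡ u'y) (U'∩W y u'y)

    size-W : size W ≡ j
    size-W = trans (∑-∈ᵇ-length C (proj₁ (proj₁ cyc))) lenC

    weight-U : weight U ≡ weight U' + (doubleEdges W + dᵥ W)
    weight-U = weight-∖-closed U W W⊆U closed

    size-U : size U ≡ size U' + j
    size-U = trans (size-∖ U W W⊆U) (cong (size U' +_) size-W)

    dᵥ-U : dᵥ U ≡ dᵥ U' + dᵥ W
    dᵥ-U = dᵥ-∖ U W W⊆U

    IH' : Claim U'
    IH' = IH U' smaller (v∉∖ U W v∉U)
      where
      smaller : size U' < size U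
      smaller = ≤-trans (≤-trans (≤-reflexive (+-comm 1 (size U'))) (+-monoʳ-≤ (size U') 1≤j)) (≤-reflexive (sym size-U))

    doubleEdges-W : doubleEdges W ≤ j * (j ∸ 1)
    doubleEdges-W = subst (λ s → doubleEdges W ≤ s * (s ∸ 1)) size-W (doubleEdges≤ W)

    dᵥ-W : dᵥ W ≤ j
    dᵥ-W = ≤-trans (∑-mono indicator≤) (≤-reflexive size-W)
      where
      indicator≤ : ∀ x → ⟦ W x ∧ a x v ⟧ ≤ ⟦ W x ⟧
      indicator≤ x with W x
      ... | true = ⟦⟧≤1 (a x v)
      ... | false = z≤n

    dᵥ-W-exceptional : Exceptional 1 U' → dᵥ W ≡ 0
    dᵥ-W-exceptional ex = ∑⟦⟧-none (λ x → W x ∧ a x v) λ w e →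
      exceptional-no-v-neighbour-out ex (v∉∖ U W v∉U) w (∈⇒≢v U w v∉U (W⊆U w (∧-elimˡ e))) (∈⇒∉∖ U W w (∧-elimˡ e)) (∧-elimʳ e)

    NonClique : Set
    NonClique = Σ[ p ∈ Fin n ] Σ[ q ∈ Fin n ] (W p ≡ true × W q ≡ true × p ≢ q × a p q ≡ false)

    doubleEdges-W-nonclique : NonClique → suc (doubleEdges W) ≤ j * (j ∸ 1)
    doubleEdges-W-nonclique (p , q , wp , wq , ne , apq) =
      subst (λ s → suc (doubleEdges W) ≤ s * (s ∸ 1)) size-W (doubleEdges-nonclique W p q wp wq ne apq)

    clique : ¬ NonClique → ∀ p q → W p ≡ true → W q ≡ true → p ≢ q → a p q ≡ true
    clique nc p q wp wq ne with a p q in e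
    ... | true = refl
    ... | false = ⊥-elim (nc (p , q , wp , wq , ne , e))

    extend : ∀ {i} → ¬ NonClique → size W ≡ 2 * k → Exceptional i U' → dᵥ U ≡ 1 → Exceptional 1 U
    extend nc sW ex = exceptional-extend U W W⊆U closed (clique nc) sW ex

    close : weight U' + (doubleEdges W + dᵥ W) ≤ 2k-1 * size U' + 2k-1 * j → weight U ≤ 2k-1 * size U
    close = split-bound (weight U') (size U') (doubleEdges W + dᵥ W) j weight-U size-U
    close-strict : suc (weight U' + (doubleEdges W + dᵥ W)) ≤ 2k-1 * size U' + 2k-1 * j → suc (weight U) ≤ 2k-1 * size U
    close-strict = split-bound-strict (weight U') (size U') (doubleEdges W + dᵥ W) j weight-U size-U

    module Full (j≡2k : j ≡ 2 * k) where
      doubleEdges-W≤ : doubleEdges W ≤ 2k-1 * j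
      doubleEdges-W≤ = ≤-trans doubleEdges-W (≤-reflexive (full-cycle-pairs j j≡2k))

      doubleEdges-W< : NonClique → suc (doubleEdges W) ≤ 2k-1 * j
      doubleEdges-W< nc = ≤-trans (doubleEdges-W-nonclique nc) (≤-reflexive (full-cycle-pairs j j≡2k))

      dᵥ-W≤1 : dᵥ W ≤ 1
      dᵥ-W≤1 with dᵥ W ≤? 1
      ... | yes p = p
      ... | no np =
        let (w₁ , w₂ , ne , e₁ , e₂) = ∑⟦⟧≥2⇒two (λ x → W x ∧ a x v) (≰⇒> np)
        in ⊥-elim (cycle-v-neighbours U c cs v∉U cyc (trans lenC j≡2k) w₁ w₂ ne (∧-elimˡ e₁) (∧-elimˡ e₂) (∧-elimʳ e₁) (∧-elimʳ e₂))

      -- A neighbour y of v outside C starts the path y v w … around C, where w is v's neighbour on C.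
      dᵥ-U' : dᵥ W ≡ 1 → dᵥ U' ≡ 0
      dᵥ-U' dW≡1 with ∑⟦⟧>0⇒∃ (λ x → W x ∧ a x v) (≤-reflexive (sym dW≡1))
      ... | w , ew with rotate-cycle U c cs cyc w (∧-elimˡ ew)
      ...   | Q , (dQ , cQ , aQ) , lQ , mQ = ∑⟦⟧-none (λ y → U' y ∧ a y v) λ y e →
        no-path-through-v U y w Q v∉U (∈⇒≢v U y v∉U (∧-elimˡ (∧-elimˡ e))) (trans (mQ y) (U'∩W y (∧-elimˡ e))) dQ cQ aQ
          (∧-elimʳ e) (∧-elimʳ ew) (≤-trans (n≤1+n 2k-1) (≤-reflexive (sym (trans lQ (trans lenC j≡2k)))))

      size-W≡2k : size W ≡ 2 * k
      size-W≡2k = trans size-W j≡2k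

      bound : ¬ Exceptional 1 U → weight U ≤ 2k-1 * size U
      bound ¬ex = by-cases (Exceptional 1 U') (decidable-stable (_ ≤? _)) λ where
        (inj₁ ex) → by-cases NonClique (decidable-stable (_ ≤? _)) λ where
          (inj₁ nc) → close (absorb-surplus (weight U') (2k-1 * size U') (doubleEdges W) (dᵥ W)
                               (ExceptionalProperties.weight-exceptional ex) (dᵥ-W-exceptional ex) (doubleEdges-W< nc))
          (inj₂ ¬nc) → ⊥-elim (¬ex (extend ¬nc size-W≡2k ex (trans dᵥ-U (cong₂ _+_ (Exceptional.v-degree ex) (dᵥ-W-exceptional ex)))))
        (inj₂ ¬ex') → case m≤n⇒m<n∨m≡n dᵥ-W≤1 of λ where
          (inj₁ dW<1) → close (+-mono-≤ (proj₁ IH' ¬ex')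
             (≤-trans (≤-reflexive (trans (cong (doubleEdges W +_) (n<1⇒n≡0 dW<1)) (+-identityʳ _))) doubleEdges-W≤))
          (inj₂ dW≡1) → by-cases (Exceptional 0 U') (decidable-stable (_ ≤? _)) λ where
            (inj₁ ex₀) → by-cases NonClique (decidable-stable (_ ≤? _)) λ where
              (inj₁ nc) → close (absorb-surplus′ (weight U') (2k-1 * size U') (doubleEdges W) (dᵥ W)
                                   (ExceptionalProperties.weight-exceptional ex₀) dW≡1 (doubleEdges-W< nc))
              (inj₂ ¬nc) → ⊥-elim (¬ex (extend ¬nc size-W≡2k ex₀ (trans dᵥ-U (cong₂ _+_ (Exceptional.v-degree ex₀) dW≡1))))
            (inj₂ ¬ex₀) → close (absorb-surplus-left (weight U') (2k-1 * size U') (doubleEdges W) (dᵥ W)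
                                   (proj₂ IH' (dᵥ-U' dW≡1) ¬ex₀) dW≡1 doubleEdges-W≤)

    bound-small : j < 2 * k → ¬ Exceptional 1 U → weight U ≤ 2k-1 * size U
    bound-small j<2k _ = by-cases (Exceptional 1 U') (decidable-stable (_ ≤? _)) λ where
      (inj₁ ex) → close (absorb-surplus (weight U') (2k-1 * size U') (doubleEdges W) (dᵥ W) (ExceptionalProperties.weight-exceptional ex)
                           (dᵥ-W-exceptional ex) (≤-trans (s≤s doubleEdges-W) (small-cycle-bound-strict j 1≤j (≤-pred j<2k))))
      (inj₂ ¬ex) → close (+-mono-≤ (proj₁ IH' ¬ex) (≤-trans (+-mono-≤ doubleEdges-W dᵥ-W) (small-cycle-bound j 1≤j (≤-pred j<2k))))

    module AwayFromV (dᵥ-U≡0 : dᵥ U ≡ 0) where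
      dᵥ-W≡0 : dᵥ W ≡ 0
      dᵥ-W≡0 = m+n≡0⇒n≡0 (dᵥ U') (trans (sym dᵥ-U) dᵥ-U≡0)

      dᵥ-U'≡0 : dᵥ U' ≡ 0
      dᵥ-U'≡0 = m+n≡0⇒m≡0 (dᵥ U') (trans (sym dᵥ-U) dᵥ-U≡0)

      weight-U'≤ : weight U' ≤ 2k-1 * size U'
      weight-U'≤ = proj₁ IH' (λ ex → 0≢1+n (trans (sym dᵥ-U'≡0) (Exceptional.v-degree ex)))

      bound-strict : ¬ Exceptional 0 U → suc (weight U) ≤ 2k-1 * size U
      bound-strict ¬ex with m≤n⇒m<n∨m≡n j≤2k
      ... | inj₁ j<2k = close-strict (absorb-strict (weight U') (2k-1 * size U') (doubleEdges W) (dᵥ W) weight-U'≤ dᵥ-W≡0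
                                        (≤-trans (s≤s doubleEdges-W) (small-cycle-bound-strict j 1≤j (≤-pred j<2k))))
      ... | inj₂ j≡2k = by-cases NonClique (decidable-stable (_ ≤? _)) λ where
        (inj₁ nc) → close-strict (absorb-strict (weight U') (2k-1 * size U') (doubleEdges W) (dᵥ W) weight-U'≤ dᵥ-W≡0
                                    (Full.doubleEdges-W< j≡2k nc))
        (inj₂ ¬nc) → by-cases (Exceptional 0 U') (decidable-stable (_ ≤? _)) λ where
          (inj₁ ex₀) → ⊥-elim (¬ex (exceptional-extend U W W⊆U closed (clique ¬nc) (Full.size-W≡2k j≡2k) ex₀ dᵥ-U≡0))
          (inj₂ ¬ex₀) → close-strict (+-mono-≤ (proj₂ IH' dᵥ-U'≡0 ¬ex₀)
                           (≤-trans (≤-reflexive (trans (cong (doubleEdges W +_) dᵥ-W≡0) (+-identityʳ _))) (Full.doubleEdges-W≤ j≡2k)))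

    claim : Claim U
    claim = bound , AwayFromV.bound-strict
      where
      bound : ¬ Exceptional 1 U → weight U ≤ 2k-1 * size U
      bound with m≤n⇒m<n∨m≡n j≤2k
      ... | inj₁ j<2k = bound-small j<2k
      ... | inj₂ j≡2k = Full.bound j≡2k

  size-cases : ∀ m → m ≡ 0 ⊎ 1 ≤ m
  size-cases zero = inj₁ refl
  size-cases (suc m) = inj₂ (s≤s z≤n)

  claim-step : ∀ U → U v ≡ false → Hypothesis U → Claim U
  claim-step U sv IH with size-cases (size U)
  ... | inj₁ e = claim-empty U e
  ... | inj₂ ne with ∑⟦⟧>0⇒∃ U ne
  ...   | x₀ , ux₀ = by-cases (Σ[ x ∈ Fin n ] U x ≡ true × deg U x < k) (claim-stable U) λ where
          (inj₁ (x , ux , dl)) → LowDegreeCase.claim U sv IH x ux dl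
          (inj₂ allHigh) → longest-path U (claim-stable U) sv x₀ ux₀ λ L pL h1 h2 mx →
             withC L h1 h2 mx (posa-cycle U L pL h1 h2 mx (λ x ux → ≮⇒≥ (λ lt → allHigh (x , ux , lt))))
    where
    withC : ∀ L → 1 ≤ length L → length L ≤ 2 * k → ¬ PathOfLength U (suc (length L)) →
            (Σ[ C ∈ List (Fin n) ] Cycle U C × length C ≡ length L) → Claim U
    withC L h1 h2 mx ((c ∷ cs) , cyc , lenC) = CycleCase.claim U sv IH c cs (length L) cyc lenC h1 h2 mx

  claim : ∀ f U → size U < f → U v ≡ false → Claim U
  claim zero U () sv
  claim (suc f) U lt sv = claim-step U sv (λ U' lt' sv' → claim f U' (≤-trans lt' (≤-pred lt)) sv')

  V-v : VSet
  V-v x = not (x == v)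

  v∉V-v : V-v v ≡ false
  v∉V-v rewrite ==-refl v = refl

  V : VSet
  V _ = true

  main-inequality : ¬ Exceptional 1 V-v → weight V-v ≤ 2k-1 * size V-v
  main-inequality = proj₁ (claim (suc (size V-v)) V-v ≤-refl v∉V-v)

  weight-V : weight V ≡ weight V-v + ((deg V v + deg V v) + ⟦ a v v ⟧)
  weight-V = weight-∖⁅⁆ V v refl

  dᵥ-V : dᵥ V ≡ deg V v
  dᵥ-V = sum-cong-≗ (λ x → cong ⟦_⟧ (asym x v))

  degree≡deg : degree G v ≡ deg V v
  degree≡deg = length-filterᵇ-tabulate (a v) (λ i → i)

  <ᵇ-asym : ∀ m n → (m <ᵇ n) ≡ true → (n <ᵇ m) ≡ false
  <ᵇ-asym zero (suc n) e = refl
  <ᵇ-asym (suc m) (suc n) e = <ᵇ-asym m n e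

  <ᵇ-tri : ∀ m n → (m <ᵇ n) ≡ false → (n <ᵇ m) ≡ false → m ≡ n
  <ᵇ-tri zero zero e1 e2 = refl
  <ᵇ-tri (suc m) (suc n) e1 e2 = cong suc (<ᵇ-tri m n e1 e2)
  <ᵇ-tri zero (suc n) () e2
  <ᵇ-tri (suc m) zero e1 ()

  precedes : Fin n → Fin n → Bool
  precedes x y = toℕ x <ᵇ toℕ y

  ordered-pair : ∀ x y → ⟦ precedes x y ∧ a x y ⟧ + ⟦ precedes y x ∧ a y x ⟧ ≡ ⟦ a x y ⟧
  ordered-pair x y rewrite asym y x with precedes x y in e1 | precedes y x in e2
  ... | true | true = ⊥-elim (t≢f (trans (sym e2) (<ᵇ-asym (toℕ x) (toℕ y) e1)))
  ... | true | false = +-identityʳ _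
  ... | false | true = refl
  ... | false | false rewrite toℕ-injective (<ᵇ-tri (toℕ x) (toℕ y) e1 e2) | airr y = refl

  edges-∑ : edges G ≡ ∑ (λ x → ∑ (λ y → ⟦ precedes x y ∧ a x y ⟧))
  edges-∑ = trans (sum-map-tabulate (λ x → length (filterᵇ (λ y → precedes x y ∧ a x y) (allFin n))) (λ i → i))
                 (sum-cong-≗ (λ x → length-filterᵇ-tabulate (λ y → precedes x y ∧ a x y) (λ i → i)))

  edges-doubleEdges : 2 * edges G ≡ doubleEdges V
  edges-doubleEdges = begin
    edges G + (edges G + 0)                     ≡⟨ cong (edges G +_) (+-identityʳ (edges G)) ⟩
    edges G + edges G                           ≡⟨ cong₂ _+_ edges-∑ (trans edges-∑ (∑-comm below)) ⟩
    ∑ (λ x → ∑ (below x)) + ∑ (λ x → ∑ (above x)) ≡⟨ ∑-distrib-+ (λ x → ∑ (below x)) (λ x → ∑ (above x)) ⟨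
    ∑ (λ x → ∑ (below x) + ∑ (above x))         ≡⟨ sum-cong-≗ (λ x → ∑-distrib-+ (below x) (above x)) ⟨
    ∑ (λ x → ∑ (λ y → below x y + above x y))   ≡⟨ sum-cong-≗ (λ x → sum-cong-≗ (ordered-pair x)) ⟩
    doubleEdges V                               ∎
    where
    open ≡-Reasoning
    below above : Fin n → Fin n → ℕ
    below x y = ⟦ precedes x y ∧ a x y ⟧
    above x y = ⟦ precedes y x ∧ a y x ⟧

  lhs≡weight : 2 * edges G ∸ degree G v ≡ weight V-v
  lhs≡weight = begin
    2 * edges G ∸ degree G v             ≡⟨ cong₂ _∸_ edges-doubleEdges degree≡deg ⟩
    doubleEdges V ∸ deg V v              ≡⟨ cong (_∸ deg V v) doubleEdges-V ⟩
    (weight V-v + deg V v) ∸ deg V v     ≡⟨ m+n∸n≡m (weight V-v) (deg V v) ⟩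
    weight V-v                           ∎
    where
    open ≡-Reasoning
    D : ℕ
    D = deg V v
    doubleEdges-V : doubleEdges V ≡ weight V-v + D
    doubleEdges-V = +-cancelʳ-≡ D (doubleEdges V) (weight V-v + D) (begin
      doubleEdges V + D                    ≡⟨ cong (doubleEdges V +_) dᵥ-V ⟨
      weight V                             ≡⟨ weight-V ⟩
      weight V-v + ((D + D) + ⟦ a v v ⟧)   ≡⟨ cong (λ b → weight V-v + ((D + D) + ⟦ b ⟧)) (airr v) ⟩
      weight V-v + ((D + D) + 0)           ≡⟨ cong (weight V-v +_) (+-identityʳ _) ⟩
      weight V-v + (D + D)                 ≡⟨ +-assoc (weight V-v) D D ⟨
      weight V-v + D + D                   ∎)

  size-V-v : size V-v ≡ n ∸ 1
  size-V-v = sym (trans (cong (_∸ 1) (sym sAll)) (m+n∸n≡m (size V-v) 1))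
    where
    sAll : size V-v + 1 ≡ n
    sAll = trans (cong (size V-v +_) (sym (size-⁅⁆ v))) (trans (sym (size-∖ V ⁅ v ⁆ (λ _ _ → refl))) (trans (∑-const {n} 1) (*-identityʳ n)))

  ≢⇒≡ᵇ-false : ∀ m n → m ≢ n → (m ≡ᵇ n) ≡ false
  ≢⇒≡ᵇ-false m n ne with m ≡ᵇ n in e
  ... | true = ⊥-elim (ne (≡ᵇ-true⇒≡ m n e))
  ... | false = refl

  ∈V-v : ∀ x → x ≢ v → V-v x ≡ true
  ∈V-v x ne rewrite ==-false ne = refl

  classSize-∑ : ∀ (c' : Fin n → ℕ) l → classSize c' l ≡ ∑ (λ y → ⟦ c' y ≡ᵇ l ⟧)
  classSize-∑ c' l = length-filterᵇ-tabulate (λ y → does (c' y ≟ l)) (λ i → i)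

  module FromExceptional (ex : Exceptional 1 V-v) where
    open Exceptional ex

    neighbour : Σ[ u ∈ Fin n ] (V-v u ∧ a u v) ≡ true
    neighbour = ∑⟦⟧>0⇒∃ (λ x → V-v x ∧ a x v) (≤-reflexive (sym v-degree))

    u : Fin n
    u = proj₁ neighbour

    u≢v : u ≢ v
    u≢v = ∈⇒≢v V-v u v∉V-v (∧-elimˡ (proj₂ neighbour))

    c′ : Fin n → ℕ
    c′ x = if x == v then c u else c x

    c′≡c : ∀ x → x ≢ v → c′ x ≡ c x
    c′≡c x ne rewrite ==-false ne = refl

    c′v : c′ v ≡ c u
    c′v rewrite ==-refl v = refl

    v-adjacent : ∀ y → Adj G v y ⇔ (y ≡ u)
    v-adjacent y = mk⇔ to (λ { refl → trans (asym v u) (∧-elimʳ (proj₂ neighbour)) })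
      where
      to : a v y ≡ true → y ≡ u
      to e with y ≟ᶠ u
      ... | yes p = p
      ... | no y≢u = ⊥-elim (1+n≰n {1} (≤-trans two (≤-reflexive v-degree)))
        where
        two : 2 ≤ dᵥ V-v
        two = two⇒∑⟦⟧≥2 (λ x → V-v x ∧ a x v) y u y≢u
                (∧-intro (∈V-v y (λ q → a≢ e (sym q))) (trans (asym y v) e)) (proj₂ neighbour)

    rest-adjacent : ∀ x y → x ≢ v → y ≢ v → Adj G x y ⇔ (x ≢ y × c′ x ≡ c′ y)
    rest-adjacent x y xv yv = mk⇔
      (λ e → a≢ e , trans (c′≡c x xv) (trans (adjacent⇒same x y (∈V-v x xv) (∈V-v y yv) e) (sym (c′≡c y yv))))
      (λ { (ne , ce) → same⇒adjacent x y (∈V-v x xv) (∈V-v y yv) ne (trans (sym (c′≡c x xv)) (trans ce (c′≡c y yv))) })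

    class-v : classSize c′ (c′ v) ≡ suc (2 * k)
    class-v = trans (classSize-∑ c′ (c′ v)) (trans (sum-cong-≗ split)
      (trans (∑-distrib-+ (λ y → ⟦ y == v ⟧) (λ y → ⟦ V-v y ∧ (c y ≡ᵇ c u) ⟧))
             (cong₂ _+_ (∑-point-1 v) (class-size u (∧-elimˡ (proj₂ neighbour))))))
      where
      split : ∀ y → ⟦ c′ y ≡ᵇ c′ v ⟧ ≡ ⟦ y == v ⟧ + ⟦ V-v y ∧ (c y ≡ᵇ c u) ⟧
      split y with y ≟ᶠ v
      ... | yes refl rewrite c′v | ==-refl v | ≡ᵇ-refl (c u) = refl
      ... | no ne rewrite c′≡c y ne | c′v | ==-false ne = refl

    class-other : ∀ x → c′ x ≢ c′ v → classSize c′ (c′ x) ≡ 2 * k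
    class-other x ne = trans (classSize-∑ c′ (c′ x)) (trans (sum-cong-≗ same) (class-size x (∈V-v x xv)))
      where
      xv : x ≢ v
      xv refl = ne refl
      c-u≢c-x : (c u ≡ᵇ c x) ≡ false
      c-u≢c-x = ≢⇒≡ᵇ-false (c u) (c x) (λ q → ne (trans (c′≡c x xv) (trans (sym q) (sym c′v))))
      same : ∀ y → ⟦ c′ y ≡ᵇ c′ x ⟧ ≡ ⟦ V-v y ∧ (c y ≡ᵇ c x) ⟧
      same y with y ≟ᶠ v
      ... | yes refl = trans (cong₂ (λ p q → ⟦ p ≡ᵇ q ⟧) c′v (c′≡c x xv))
                             (trans (cong ⟦_⟧ c-u≢c-x) (sym (cong (λ b → ⟦ b ∧ (c v ≡ᵇ c x) ⟧) v∉V-v)))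
      ... | no y≢v rewrite c′≡c y y≢v | c′≡c x xv | ==-false y≢v = refl

    isExceptional : IsExceptional k G v
    isExceptional = c′ , u , u≢v , trans (c′≡c u u≢v) (sym c′v) , v-adjacent , rest-adjacent , class-v , class-other

lemma2 : (k : ℕ) → 1 ≤ k → (n : ℕ) → (G : Graph n) → (v : Fin n)
    → ¬ HasPathAvoidingEnds G v (2 * k)
    → ¬ IsExceptional k G v
    → 2 * edges G ∸ degree G v ≤ (2 * k ∸ 1) * (n ∸ 1)
lemma2 (suc k') _ n G v noPath ¬exceptional =
  subst₂ _≤_ (sym lhs≡weight) (cong (2k-1 *_) size-V-v)
         (main-inequality (λ ex → ¬exceptional (FromExceptional.isExceptional ex)))
  where open Proof G v k' noPath
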